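{- Let $L \in \mathbb{Q}\setminus\{0,1\}$ be such that $L^2-L+1$ is the square of a rational number, and let $E_L: y^2 = x(x-1)(x-L)$. If $K/\mathbb{Q}$ is a quadratic extension, then the torsion subgroup $T_L(K)$ of $E_L(K)$ contains a point of order $4$ if and only if $K = \mathbb{Q}(\sqrt{1-L})$. -}

module Defs where

open import Data.Rational using (ℚ; _+_; _*_; _-_; -_; 0ℚ; 1ℚ)
open import Data.Product using (Σ; ∃; _×_; _,_)
open import Data.Sum using (_⊎_)
open import Relation.Binary.PropositionalEquality using (_≡_)
open import Relation.Nullary using (¬_)

IsSquare : ℚ → Set
IsSquare q = ∃ λ r → r * r ≡ q

2ℚ : ℚ
2ℚ = 1ℚ + 1ℚ

3ℚ : ℚ
3ℚ = 2ℚ + 1ℚ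

-- The quadratic field ℚ(√d) (d a non-square rational), elements a + b√d.
record QF (d : ℚ) : Set where
  constructor ⟨_,_⟩
  field
    re : ℚ
    im : ℚ
open QF public

module _ {d : ℚ} where
  infixl 6 _⊕_ _⊖_
  infixl 7 _⊗_

  ι : ℚ → QF d
  ι q = ⟨ q , 0ℚ ⟩

  _⊕_ : QF d → QF d → QF d
  ⟨ a , b ⟩ ⊕ ⟨ c , e ⟩ = ⟨ a + c , b + e ⟩

  ⊝_ : QF d → QF d
  ⊝ ⟨ a , b ⟩ = ⟨ - a , - b ⟩

  _⊖_ : QF d → QF d → QF d
  x ⊖ y = x ⊕ (⊝ y)

  -- (a + b√d)(c + e√d) = (ac + d be) + (ae + bc)√d
  _⊗_ : QF d → QF d → QF d
  ⟨ a , b ⟩ ⊗ ⟨ c , e ⟩ = ⟨ a * c + d * (b * e) , a * e + b * c ⟩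

OnCurve : (L d : ℚ) → QF d → QF d → Set
OnCurve L d x y = y ⊗ y ≡ x ⊗ (x ⊖ ι 1ℚ) ⊗ (x ⊖ ι L)

-- Doubling in the group law (tangent construction) for an affine point
-- P = (x , y) with y ≠ 0 on y² = x³ + a x² + b x, here a = -(1+L), b = L:
--   λ · 2y = 3x² + 2a x + b,  x(2P) = λ² - a - 2x,  y(2P) = λ(x - x(2P)) - y.
Doubles : (L d : ℚ) → QF d → QF d → QF d → QF d → Set
Doubles L d x y x₂ y₂ =
  ¬ (y ≡ ι 0ℚ) × Σ (QF d) λ l →
      (l ⊗ (ι 2ℚ ⊗ y) ≡ ι 3ℚ ⊗ x ⊗ x ⊖ ι (2ℚ * (1ℚ + L)) ⊗ x ⊕ ι L)
    × (x₂ ≡ l ⊗ l ⊕ ι (1ℚ + L) ⊖ ι 2ℚ ⊗ x)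
    × (y₂ ≡ l ⊗ (x ⊖ x₂) ⊖ y)

-- E_L(ℚ(√d)) contains a point of order 4: an affine point P ∈ E_L(K) whose
-- double 2P is an affine point (so 2P ≠ O) of order 2 (y(2P) = 0, i.e. 4P = O).
-- (Any point of order 4 is torsion, so this is a point of order 4 of T_L(K).)
HasPointOfOrder4 : (L d : ℚ) → Set
HasPointOfOrder4 L d =
  Σ (QF d) λ x → Σ (QF d) λ y → Σ (QF d) λ x₂ → Σ (QF d) λ y₂ →
    OnCurve L d x y × Doubles L d x y x₂ y₂ × (y₂ ≡ ι 0ℚ)

module Submission where

-- A point P of order 4 doubles to a point (x₂, 0) of order 2 with x₂ ∈ {0, 1, L}, and the tangent
-- at P shows that x₂ - e is a square in K = ℚ(√d) for each root e of x(x - 1)(x - L). A rational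
-- number that is a square in K is a rational square or d times one. When L² - L + 1 is a square,
-- none of L, 1 - L, -L, L - 1, -1, L(L - 1) is a rational square: through t ↦ 1 - t and t ↦ 1/t,
-- which preserve t² - t + 1 up to squares, each would give a rational point on u⁴ ∓ u² + 1 = w²,
-- and by Fermat's infinite descent on x⁴ ∓ x²y² + y⁴ = z² these have only u ∈ {0, ±1} (resp. u = 0).
-- This rules out x₂ = 0 and x₂ = L, and for x₂ = 1 forces 1 - L = d b², i.e. d(1 - L) = (db)².
-- Conversely, if r ∈ K satisfies r² = 1 - L, the point (1 + r, r(1 + r)) has order 4.

module Arithmetic where

  open import Data.Nat
  open import Data.Nat.Properties
  open import Data.Nat.Divisibility
  open import Data.Nat.DivMod using (_%_; [m+kn]%n≡m%n)
  open import Data.Nat.GCD using (gcd; gcd[m,n]∣m; gcd[m,n]∣n; gcd-greatest; c*gcd[m,n]≡gcd[cm,cn])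
  open import Data.Nat.Coprimality as Coprimality using (Coprime; coprime-divisor)
  open import Data.Nat.Primality using (Prime; prime?; euclidsLemma)
  open import Data.Nat.Tactic.RingSolver using (solve)
  open import Data.List using ([]; _∷_)
  open import Data.Product
  open import Data.Sum
  open import Data.Empty using (⊥-elim)
  open import Function.Base using (_∋_)
  open import Relation.Nullary using (¬_; contradiction; yes; no)
  open import Relation.Nullary.Decidable using (toWitness)
  open import Relation.Binary.PropositionalEquality

  _² : ℕ → ℕ
  n ² = n * n

  ²-distrib-* : ∀ m n → (m * n) ² ≡ m ² * n ²
  ²-distrib-* m n = (m * n) * (m * n) ≡ (m * m) * (n * n) ∋ solve (m ∷ n ∷ [])

  ²-mono-< : ∀ {m n} → m < n → m ² < n ²
  ²-mono-< m<n = *-mono-< m<n m<n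

  ²-cancel-≤ : ∀ {m n} → m ² ≤ n ² → m ≤ n
  ²-cancel-≤ {m} {n} m²≤n² with m ≤? n
  ... | yes m≤n = m≤n
  ... | no m≰n = contradiction m²≤n² (<⇒≱ (²-mono-< (≰⇒> m≰n)))

  ²-injective : ∀ {m n} → m ² ≡ n ² → m ≡ n
  ²-injective eq = ≤-antisym (²-cancel-≤ (≤-reflexive eq)) (²-cancel-≤ (≤-reflexive (sym eq)))

  ²-positive : ∀ {n} → n ≢ 0 → n ² > 0
  ²-positive n≢0 = *-mono-≤ (n≢0⇒n>0 n≢0) (n≢0⇒n>0 n≢0)

  n≤n² : ∀ n → n ≤ n ²
  n≤n² zero = z≤n
  n≤n² n@(suc _) = m≤m*n n n

  2mn≤m²+n² : ∀ m n → 2 * (m * n) ≤ m ² + n ²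
  2mn≤m²+n² m n with ≤-total m n
  ... | inj₁ m≤n with k , refl ← m≤n⇒∃[o]m+o≡n m≤n =
    ≤-trans (m≤m+n _ (k * k)) (≤-reflexive (2 * (m * (m + k)) + k * k ≡ m * m + (m + k) * (m + k) ∋ solve (m ∷ k ∷ [])))
  ... | inj₂ n≤m with k , refl ← m≤n⇒∃[o]m+o≡n n≤m =
    ≤-trans (m≤m+n _ (k * k)) (≤-reflexive (2 * ((n + k) * n) + k * k ≡ (n + k) * (n + k) + n * n ∋ solve (n ∷ k ∷ [])))

  difference-of-squares : ∀ {x t r} → x ² ≡ t ² + r → ∃ λ q → q * (q + 2 * t) ≡ r
  difference-of-squares {x} {t} {r} x²≡t²+r
    with q , refl ← m≤n⇒∃[o]m+o≡n (²-cancel-≤ {t} {x} (≤-trans (m≤m+n (t ²) r) (≤-reflexive (sym x²≡t²+r)))) =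
    q , +-cancelˡ-≡ (t ²) _ _ (trans (t * t + q * (q + 2 * t) ≡ (t + q) * (t + q) ∋ solve (t ∷ q ∷ [])) x²≡t²+r)

  Even Odd : ℕ → Set
  Even n = ∃ λ k → n ≡ 2 * k
  Odd n = ∃ λ k → n ≡ 1 + 2 * k

  even⊎odd : ∀ n → Even n ⊎ Odd n
  even⊎odd zero = inj₁ (0 , refl)
  even⊎odd (suc n) with even⊎odd n
  ... | inj₁ (k , refl) = inj₂ (k , refl)
  ... | inj₂ (k , refl) = inj₁ (suc k , cong suc (sym (+-suc k (k + 0))))

  ≡-mod : ∀ n .{{_ : NonZero n}} {r s} a b → r + n * a ≡ s + n * b → r % n ≡ s % n
  ≡-mod n {r} {s} a b eq = begin
    r % n            ≡⟨ sym ([m+kn]%n≡m%n r a n) ⟩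
    (r + a * n) % n  ≡⟨ cong (λ t → (r + t) % n) (*-comm a n) ⟩
    (r + n * a) % n  ≡⟨ cong (_% n) eq ⟩
    (s + n * b) % n  ≡⟨ cong (λ t → (s + t) % n) (*-comm n b) ⟩
    (s + b * n) % n  ≡⟨ [m+kn]%n≡m%n s b n ⟩
    s % n            ∎
    where open ≡-Reasoning

  even⇒¬odd : ∀ {n} → Even n → ¬ Odd n
  even⇒¬odd (a , refl) (b , eq) with ≡-mod 2 {0} {1} a b eq
  ... | ()

  *-pres-odd : ∀ {m n} → Odd m → Odd n → Odd (m * n)
  *-pres-odd (k , refl) (l , refl) = k + l + 2 * k * l , solve (k ∷ l ∷ [])

  odd[m*n]⇒odd[m] : ∀ m n → Odd (m * n) → Odd m
  odd[m*n]⇒odd[m] m n odd with even⊎odd m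
  ... | inj₂ odd-m = odd-m
  ... | inj₁ (k , refl) = ⊥-elim (even⇒¬odd (k * n , *-assoc 2 k n) odd)

  odd[m*n]⇒odd[n] : ∀ m n → Odd (m * n) → Odd n
  odd[m*n]⇒odd[n] m n odd = odd[m*n]⇒odd[m] n m (subst Odd (*-comm m n) odd)

  odd-∣ : ∀ {m n} → Odd n → m ∣ n → Odd m
  odd-∣ {m} odd (divides k refl) = odd[m*n]⇒odd[n] k m odd

  odd⇒≢0 : ∀ {n} → Odd n → n ≢ 0
  odd⇒≢0 (k , refl) ()

  odd+odd⇒even : ∀ {m n} → Odd m → Odd n → Even (m + n)
  odd+odd⇒even (i , refl) (j , refl) = 1 + i + j , solve (i ∷ j ∷ [])

  even+odd⇒odd : ∀ {m n} → Even m → Odd n → Odd (m + n)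
  even+odd⇒odd (i , refl) (j , refl) = i + j , solve (i ∷ j ∷ [])

  even⇒even² : ∀ {n} → Even n → Even (n ²)
  even⇒even² (i , refl) = 2 * i * i , (2 * i * (2 * i) ≡ 2 * (2 * i * i) ∋ solve (i ∷ []))

  odd-sum-of-squares : ∀ m n → Odd (m ² + n ²) → Even m × Odd n ⊎ Odd m × Even n
  odd-sum-of-squares m n odd with even⊎odd m | even⊎odd n
  ... | inj₁ even-m | inj₂ odd-n = inj₁ (even-m , odd-n)
  ... | inj₂ odd-m | inj₁ even-n = inj₂ (odd-m , even-n)
  ... | inj₁ (i , refl) | inj₁ (j , refl) =
    ⊥-elim (even⇒¬odd {2 * i * (2 * i) + 2 * j * (2 * j)} (2 * i * i + 2 * j * j , solve (i ∷ j ∷ [])) odd)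
  ... | inj₂ (i , refl) | inj₂ (j , refl) =
    ⊥-elim (even⇒¬odd {(1 + 2 * i) * (1 + 2 * i) + (1 + 2 * j) * (1 + 2 * j)}
      (1 + 2 * i + 2 * i * i + 2 * j + 2 * j * j , solve (i ∷ j ∷ [])) odd)

  odd-factors : ∀ {a b m} → a * b ≡ m → Odd m → Odd a × Odd b
  odd-factors {a} {b} refl odd = odd[m*n]⇒odd[m] a b odd , odd[m*n]⇒odd[n] a b odd

  factor≤product : ∀ {a b m} → a * b ≡ m → Odd m → b ≤ m
  factor≤product {a} {b} refl odd with odd-factors {a} {b} refl odd
  ... | (k , refl) , _ = m≤n*m b (1 + 2 * k)

  odd-gap : ∀ {m n} → Odd m → Odd n → m ≤ n → ∃ λ d → n ≡ m + 2 * d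
  odd-gap (k , refl) (l , refl) (s≤s 2k≤2l) with m≤n⇒∃[o]m+o≡n (*-cancelˡ-≤ {k} {l} 2 2k≤2l)
  ... | j , refl = j , solve (k ∷ j ∷ [])

  odd⇒²≡1+8k : ∀ {n} → Odd n → ∃ λ k → n ² ≡ 1 + 8 * k
  odd⇒²≡1+8k (k , refl) with even⊎odd k
  ... | inj₁ (i , refl) = i * (1 + 2 * i) , solve (i ∷ [])
  ... | inj₂ (i , refl) = (1 + 2 * i) * (1 + i) , solve (i ∷ [])

  mod8-obstruction : ∀ {x y} k l → Odd x → Odd y → 3 * x ² ² + 2 * (x * y) ² + 8 * k ≢ y ² ² + 8 * l
  mod8-obstruction {x} {y} k l odd-x odd-y eq
    with i , x²≡ ← odd⇒²≡1+8k odd-x | j , y²≡ ← odd⇒²≡1+8k odd-y =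
    contradiction (≡-mod 8 {5} {1} (8 * i + 24 * i * i + 2 * j + 16 * i * j + k) (2 * j + 8 * j * j + l) five≡one) λ ()
    where
    open ≡-Reasoning
    five≡one : 5 + 8 * (8 * i + 24 * i * i + 2 * j + 16 * i * j + k) ≡ 1 + 8 * (2 * j + 8 * j * j + l)
    five≡one = begin
      5 + 8 * (8 * i + 24 * i * i + 2 * j + 16 * i * j + k)
        ≡⟨ solve (i ∷ j ∷ k ∷ []) ⟩
      3 * ((1 + 8 * i) * (1 + 8 * i)) + 2 * ((1 + 8 * i) * (1 + 8 * j)) + 8 * k
        ≡⟨ cong₂ (λ s t → 3 * s ² + 2 * (s * t) + 8 * k) x²≡ y²≡ ⟨
      3 * x ² ² + 2 * (x ² * y ²) + 8 * k
        ≡⟨ cong (λ t → 3 * x ² ² + 2 * t + 8 * k) (²-distrib-* x y) ⟨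
      3 * x ² ² + 2 * (x * y) ² + 8 * k
        ≡⟨ eq ⟩
      y ² ² + 8 * l
        ≡⟨ cong (λ t → t ² + 8 * l) y²≡ ⟩
      (1 + 8 * j) * (1 + 8 * j) + 8 * l
        ≡⟨ solve (j ∷ l ∷ []) ⟩
      1 + 8 * (2 * j + 8 * j * j + l) ∎

  ²≢3+8k : ∀ {n} k → n ² ≢ 3 + 8 * k
  ²≢3+8k {n} k eq with even⊎odd n
  ... | inj₁ (i , refl) = even⇒¬odd {2 * i * (2 * i)} (2 * i * i , solve (i ∷ [])) (1 + 4 * k , trans eq (solve (k ∷ [])))
  ... | inj₂ odd-n with j , n²≡1+8j ← odd⇒²≡1+8k odd-n =
    contradiction (≡-mod 8 {1} {3} j k (trans (sym n²≡1+8j) eq)) λ ()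

  ∣m+n∣n⇒∣m : ∀ {d m n} → d ∣ m + n → d ∣ n → d ∣ m
  ∣m+n∣n⇒∣m {d} {m} {n} d∣m+n d∣n = ∣m+n∣m⇒∣n (subst (d ∣_) (+-comm m n) d∣m+n) d∣n

  coprime-∣ˡ : ∀ {m n d} → Coprime m n → d ∣ m → Coprime d n
  coprime-∣ˡ coprime d∣m (e∣d , e∣n) = coprime (∣-trans e∣d d∣m , e∣n)

  coprime-∣ʳ : ∀ {m n d} → Coprime m n → d ∣ n → Coprime m d
  coprime-∣ʳ coprime d∣n (e∣m , e∣d) = coprime (e∣m , ∣-trans e∣d d∣n)

  *-pres-coprimeˡ : ∀ {m n o} → Coprime m n → Coprime o n → Coprime (m * o) n
  *-pres-coprimeˡ m⊥n o⊥n (d∣mo , d∣n) =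
    o⊥n (coprime-divisor (Coprimality.sym (coprime-∣ʳ m⊥n d∣n)) d∣mo , d∣n)

  *-pres-coprimeʳ : ∀ {m n o} → Coprime m n → Coprime m o → Coprime m (n * o)
  *-pres-coprimeʳ m⊥n m⊥o = Coprimality.sym (*-pres-coprimeˡ (Coprimality.sym m⊥n) (Coprimality.sym m⊥o))

  coprime-²ˡ : ∀ {m n} → Coprime m n → Coprime (m ²) n
  coprime-²ˡ m⊥n = *-pres-coprimeˡ m⊥n m⊥n

  coprime-²ʳ : ∀ {m n} → Coprime m n → Coprime m (n ²)
  coprime-²ʳ m⊥n = *-pres-coprimeʳ m⊥n m⊥n

  even∧even⇒¬coprime : ∀ {m n} → Even m → Even n → ¬ Coprime m n
  even∧even⇒¬coprime (i , refl) (j , refl) coprime with () ← coprime (divides i (*-comm 2 i) , divides j (*-comm 2 j))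

  odd⇒coprime-2 : ∀ {n} → Odd n → Coprime n 2
  odd⇒coprime-2 odd {0} (_ , 0∣2) with () ← 0∣⇒≡0 0∣2
  odd⇒coprime-2 odd {1} _ = refl
  odd⇒coprime-2 odd {2} (divides q refl , _) = ⊥-elim (even⇒¬odd (q , *-comm q 2) odd)
  odd⇒coprime-2 odd {suc (suc (suc _))} (_ , 3+d∣2) with ∣⇒≤ 3+d∣2
  ... | s≤s (s≤s ())

  ²∣3⇒≡1 : ∀ {h} → h ² ∣ 3 → h ≡ 1
  ²∣3⇒≡1 {0} 0∣3 with () ← 0∣⇒≡0 0∣3
  ²∣3⇒≡1 {1} _ = refl
  ²∣3⇒≡1 {suc (suc h)} h²∣3 = contradiction (≤-trans 4≤h² (∣⇒≤ h²∣3)) λ { (s≤s (s≤s (s≤s ()))) }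
    where
    4≤h² : 4 ≤ (2 + h) ²
    4≤h² = *-mono-≤ (m≤m+n 2 h) (m≤m+n 2 h)

  coprime-square-productˡ : ∀ {m n k} → Coprime m n → m * n ≡ k ² → ∃ λ a → m ≡ a ²
  coprime-square-productˡ {m} {n} {k} m⊥n mn≡k² = g , ∣-antisym m∣g² g²∣m
    where
    g = gcd m k
    g∣k = gcd[m,n]∣n m k
    m∣gk : m ∣ g * k
    m∣gk = subst (m ∣_) (trans (sym (c*gcd[m,n]≡gcd[cm,cn] k m k)) (*-comm k g))
             (gcd-greatest (n∣m*n k) (subst (m ∣_) mn≡k² (m∣m*n n)))
    m∣g² : m ∣ g ²
    m∣g² = subst (m ∣_) (sym (c*gcd[m,n]≡gcd[cm,cn] g m k)) (gcd-greatest (n∣m*n g) m∣gk)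
    g²∣m : g ² ∣ m
    g²∣m = coprime-divisor (coprime-²ˡ (coprime-∣ˡ m⊥n (gcd[m,n]∣m m k)))
             (subst (g ² ∣_) (trans (sym mn≡k²) (*-comm m n)) (*-pres-∣ g∣k g∣k))

  coprime-square-product : ∀ {m n k} → Coprime m n → m * n ≡ k ² →
    ∃₂ λ a b → m ≡ a ² × n ≡ b ² × a * b ≡ k × Coprime a b
  coprime-square-product {m} {n} {k} m⊥n mn≡k²
    with a , refl ← coprime-square-productˡ {k = k} m⊥n mn≡k²
       | b , refl ← coprime-square-productˡ {k = k} (Coprimality.sym m⊥n) (trans (*-comm n m) mn≡k²) =
    a , b , refl , refl , ²-injective (trans (²-distrib-* a b) mn≡k²) ,
    coprime-∣ʳ (coprime-∣ˡ m⊥n (m∣m*n a)) (m∣m*n b)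

  pairwise-coprime-square-product : ∀ {a b c k} → Coprime a b → Coprime a c → Coprime b c → a * b * c ≡ k ² →
    ∃[ α ] ∃[ β ] ∃[ γ ] a ≡ α ² × b ≡ β ² × c ≡ γ ² × Coprime α β
  pairwise-coprime-square-product {k = k} a⊥b a⊥c b⊥c abc≡k²
    with w , γ , ab≡w² , c≡γ² , _ ← coprime-square-product {k = k} (*-pres-coprimeˡ a⊥c b⊥c) abc≡k²
    with α , β , a≡α² , b≡β² , _ , α⊥β ← coprime-square-product {k = w} a⊥b ab≡w² =
    α , β , γ , a≡α² , b≡β² , c≡γ² , α⊥β

  coprime-fourth-power-product : ∀ {m n k} → Coprime m n → m * n ≡ k ² ² →
    ∃₂ λ a b → m ≡ a ² ² × n ≡ b ² ² × a * b ≡ k × Coprime a b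
  coprime-fourth-power-product {k = k} m⊥n mn≡k⁴
    with a² , b² , refl , refl , a²b²≡k² , a²⊥b² ← coprime-square-product {k = k ²} m⊥n mn≡k⁴
    with a , b , refl , refl , ab≡k , a⊥b ← coprime-square-product {k = k} a²⊥b² a²b²≡k² =
    a , b , refl , refl , ab≡k , a⊥b

  prime-3 : Prime 3
  prime-3 = toWitness {a? = prime? 3} _

  coprime-3·fourth-power-product : ∀ {m n k} → Coprime m n → m * n ≡ 3 * k ² ² →
    ∃₂ λ a b → a * b ≡ k × Coprime a b × (m ≡ 3 * a ² ² × n ≡ b ² ² ⊎ m ≡ a ² ² × n ≡ 3 * b ² ²)
  coprime-3·fourth-power-product {m} {n} {k} m⊥n mn≡3k⁴
    with euclidsLemma m n prime-3 (divides (k ² ²) (trans mn≡3k⁴ (*-comm 3 (k ² ²))))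
  ... | inj₁ (divides q refl)
    with a , b , refl , refl , ab≡k , a⊥b ← coprime-fourth-power-product {q} {n} {k} (coprime-∣ˡ m⊥n (m∣m*n 3))
           (*-cancelˡ-≡ _ _ 3 (trans (3 * (q * n) ≡ q * 3 * n ∋ solve (q ∷ n ∷ [])) mn≡3k⁴)) =
    a , b , ab≡k , a⊥b , inj₁ (*-comm (a ² ²) 3 , refl)
  ... | inj₂ (divides q refl)
    with a , b , refl , refl , ab≡k , a⊥b ← coprime-fourth-power-product {m} {q} {k} (coprime-∣ʳ m⊥n (m∣m*n 3))
           (*-cancelˡ-≡ _ _ 3 (trans (3 * (m * q) ≡ m * (q * 3) ∋ solve (m ∷ q ∷ [])) mn≡3k⁴)) =
    a , b , ab≡k , a⊥b , inj₂ (refl , *-comm (b ² ²) 3)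

  coprime-q[q+2t] : ∀ {q t m} → Odd m → Coprime t m → q * (q + 2 * t) ≡ 3 * m ² ² → Coprime q (q + 2 * t)
  coprime-q[q+2t] {q} {t} {m} odd-m t⊥m eq {h} (h∣q , h∣q+2t) = ²∣3⇒≡1 h²∣3
    where
    odd-m² = *-pres-odd odd-m odd-m
    odd-q : Odd q
    odd-q = odd[m*n]⇒odd[m] q _ (subst Odd (sym eq) (*-pres-odd (1 , refl) (*-pres-odd odd-m² odd-m²)))
    h∣t : h ∣ t
    h∣t = coprime-divisor (odd⇒coprime-2 (odd-∣ odd-q h∣q)) (∣m+n∣m⇒∣n h∣q+2t h∣q)
    h⊥m : Coprime h m
    h⊥m (g∣h , g∣m) = t⊥m (∣-trans g∣h h∣t , g∣m)
    h²∣3 : h ² ∣ 3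
    h²∣3 = coprime-divisor (coprime-²ˡ (coprime-²ʳ (coprime-²ʳ h⊥m)))
             (subst (h ² ∣_) (trans eq (*-comm 3 (m ² ²))) (*-pres-∣ h∣q h∣q+2t))

module Quartic where

  open Arithmetic
  open import Data.Nat
  open import Data.Nat.Properties
  open import Data.Nat.Divisibility
  open import Data.Nat.Coprimality as Coprimality using (Coprime; coprime-divisor)
  open import Data.Nat.Induction using (<-wellFounded)
  open import Data.Nat.Tactic.RingSolver using (solve; solve-∀)
  open import Data.List using ([]; _∷_)
  open import Data.Product
  open import Data.Sum
  open import Data.Empty using (⊥-elim)
  open import Function.Base using (_∋_)
  open import Induction.InfiniteDescent using (descent∧wf⇒empty)
  open import Relation.Nullary using (¬_; contradiction; yes; no)
  open import Relation.Binary.PropositionalEquality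

  -- x⁴ + x²y² + y⁴ = z² and x⁴ - x²y² + y⁴ = z², the latter with x²y² moved across.
  Quartic⁺ Quartic⁻ : ℕ → ℕ → ℕ → Set
  Quartic⁺ x y z = x ² ² + x ² * y ² + y ² ² ≡ z ²
  Quartic⁻ x y z = x ² ² + y ² ² ≡ z ² + x ² * y ²

  quartic⁺-sym : ∀ x y z → Quartic⁺ x y z → Quartic⁺ y x z
  quartic⁺-sym x y _ eq = trans
    (y * y * (y * y) + y * y * (x * x) + x * x * (x * x) ≡ x * x * (x * x) + x * x * (y * y) + y * y * (y * y)
      ∋ solve (x ∷ y ∷ []))
    eq

  quartic⁻-sym : ∀ x y z → Quartic⁻ x y z → Quartic⁻ y x z
  quartic⁻-sym x y z eq = trans (+-comm (y ² ²) (x ² ²)) (trans eq (cong (z ² +_) (*-comm (x ² ) (y ²))))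

  module Descent {F : ℕ → ℕ → ℕ → Set} (F-sym : ∀ x y z → F x y z → F y x z) where

    record Nontrivial (y : ℕ) : Set where
      field
        {x z} : ℕ
        even-x : Even x
        x≢0 : x ≢ 0
        odd-y : Odd y
        x⊥y : Coprime x y
        solution : F x y z

    Descends : Set
    Descends = ∀ {y} → Nontrivial y → ∃ λ y′ → y′ < y × Nontrivial y′

    descend-from-squares : ∀ {α β u A} → α ² + β ² ≡ A → Odd A → Coprime α β → α ≢ 0 → β ≢ 0 → F α β u →
      ∃ λ y → y < A × Nontrivial y
    descend-from-squares {α} {β} {u} refl odd-A α⊥β α≢0 β≢0 sol with odd-sum-of-squares α β odd-A
    ... | inj₁ (even-α , odd-β) =
      β , ≤-<-trans (n≤n² β) (m<n+m (β ²) (²-positive α≢0)) ,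
      record { even-x = even-α ; x≢0 = α≢0 ; odd-y = odd-β ; x⊥y = α⊥β ; solution = sol }
    ... | inj₂ (odd-α , even-β) =
      α , ≤-<-trans (n≤n² α) (m<m+n (α ²) (²-positive β≢0)) ,
      record { even-x = even-β ; x≢0 = β≢0 ; odd-y = odd-α ; x⊥y = Coprimality.sym α⊥β ; solution = F-sym α β u sol }

    no-nontrivial-solution : Descends → ∀ y → ¬ Nontrivial y
    no-nontrivial-solution descends = descent∧wf⇒empty descends <-wellFounded

    even-odd-solution⇒0 : Descends → ∀ {x y z} → Even x → Odd y → Coprime x y → F x y z → x ≡ 0
    even-odd-solution⇒0 descends {zero} _ _ _ _ = refl
    even-odd-solution⇒0 descends {suc _} even-x odd-y x⊥y sol =
      ⊥-elim (no-nontrivial-solution descends _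
        (record { even-x = even-x ; x≢0 = λ () ; odd-y = odd-y ; x⊥y = x⊥y ; solution = sol }))

    -- With c = B + d, the factors of n² = c·d·K are pairwise coprime, hence squares α², β², u²,
    -- and α² + β² = B + 2d is odd, so exactly one of α, β is even.
    descend-from-factorisation : ∀ {B d n K} X Y → Odd (B + 2 * d) → Coprime (B + 2 * d) B → n ≢ 0 →
      n ² ≡ (B + d) * d * K → K ≡ (B + d) * X + d ² → K ≡ B ² + d * Y →
      (∀ α β u → B + d ≡ α ² → d ≡ β ² → K ≡ u ² → F α β u) →
      ∃ λ y → y < B + 2 * d × Nontrivial y
    descend-from-factorisation {B} {d} {n} {K} X Y odd-A A⊥B n≢0 n²≡cdK K≡cX+d² K≡B²+dY solution
      = finish (pairwise-coprime-square-product {k = n} c⊥d c⊥K d⊥K (sym n²≡cdK))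
      where
      c = B + d
      g∣A : ∀ {g} → g ∣ B → g ∣ d → g ∣ B + 2 * d
      g∣A g∣B g∣d = ∣m∣n⇒∣m+n g∣B (∣n⇒∣m*n 2 g∣d)
      c⊥d : Coprime c d
      c⊥d {g} (g∣c , g∣d) = A⊥B (g∣A g∣B g∣d , g∣B)
        where g∣B = ∣m+n∣m⇒∣n (subst (g ∣_) (+-comm B d) g∣c) g∣d
      d⊥B : Coprime d B
      d⊥B (g∣d , g∣B) = A⊥B (g∣A g∣B g∣d , g∣B)
      c⊥K : Coprime c K
      c⊥K {g} (g∣c , g∣K) = coprime-²ʳ c⊥d (g∣c , ∣m+n∣m⇒∣n (subst (g ∣_) K≡cX+d² g∣K) (∣m⇒∣m*n X g∣c))
      d⊥K : Coprime d K
      d⊥K {g} (g∣d , g∣K) =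
        coprime-²ʳ d⊥B (g∣d , ∣m+n∣n⇒∣m (subst (g ∣_) K≡B²+dY g∣K) (∣m⇒∣m*n Y g∣d))
      finish : (∃[ α ] ∃[ β ] ∃[ u ] c ≡ α ² × d ≡ β ² × K ≡ u ² × Coprime α β) →
               ∃ λ y → y < B + 2 * d × Nontrivial y
      finish (α , β , u , c≡α² , d≡β² , K≡u² , α⊥β) =
        descend-from-squares {u = u} α²+β²≡A odd-A α⊥β α≢0 β≢0 (solution α β u c≡α² d≡β² K≡u²)
        where
        α²+β²≡A : α ² + β ² ≡ B + 2 * d
        α²+β²≡A = trans (cong₂ _+_ (sym c≡α²) (sym d≡β²)) (B + d + d ≡ B + 2 * d ∋ solve (B ∷ d ∷ []))
        α≢0 : α ≢ 0
        α≢0 refl = n≢0 (²-injective (trans n²≡cdK (cong (λ t → t * d * K) c≡α²)))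
        β≢0 : β ≢ 0
        β≢0 refl = n≢0 (²-injective (trans n²≡cdK (trans (cong (λ t → c * t * K) d≡β²) (cong (_* K) (*-zeroʳ c)))))

  module Descent⁺ = Descent quartic⁺-sym
  module Descent⁻ = Descent quartic⁻-sym

  reduced⁺⇒B≤A : ∀ {A B k} → 3 * A ² ² ≡ B ² ² + 2 * (k + (A * B) ²) → B ≤ A
  reduced⁺⇒B≤A {A} {B} {k} eq with B ≤? A
  ... | yes B≤A = B≤A
  ... | no B≰A = contradiction eq (<⇒≢ (begin-strict
    3 * A ² ²                  ≡⟨ solve (A ∷ []) ⟩
    A ² ² + 2 * (A ² * A ²)      <⟨ +-mono-<-≤ (²-mono-< A²<B²) (*-monoʳ-≤ 2 (*-monoʳ-≤ (A ²) (<⇒≤ A²<B²))) ⟩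
    B ² ² + 2 * (A ² * B ²)      ≡⟨ cong (λ t → B ² ² + 2 * t) (²-distrib-* A B) ⟨
    B ² ² + 2 * (A * B) ²        ≤⟨ +-monoʳ-≤ (B ² ²) (*-monoʳ-≤ 2 (m≤n+m ((A * B) ²) k)) ⟩
    B ² ² + 2 * (k + (A * B) ²)  ∎))
    where
    open ≤-Reasoning
    A²<B² = ²-mono-< (≰⇒> B≰A)

  descend-from-reduced⁺ : ∀ {A B n} → Odd A → Odd B → Coprime A B → n ≢ 0 →
    3 * A ² ² ≡ B ² ² + 2 * (2 * (2 * n) ² + (A * B) ²) → ∃ λ y → y < A × Descent⁺.Nontrivial y
  descend-from-reduced⁺ {A} {B} {n} odd-A odd-B A⊥B n≢0 eq with odd-gap odd-B odd-A (reduced⁺⇒B≤A {k = 2 * (2 * n) ²} eq)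
  ... | d , refl =
    Descent⁺.descend-from-factorisation (B + 2 * d) (3 * B + 3 * d) odd-A A⊥B n≢0 n²≡cdK
      (B * B + 3 * B * d + 3 * (d * d) ≡ (B + d) * (B + 2 * d) + d * d ∋ solve (B ∷ d ∷ []))
      (B * B + 3 * B * d + 3 * (d * d) ≡ B * B + d * (3 * B + 3 * d) ∋ solve (B ∷ d ∷ []))
      solution
    where
    open ≡-Reasoning
    n²≡cdK : n ² ≡ (B + d) * d * (B ² + 3 * B * d + 3 * d ²)
    n²≡cdK = *-cancelˡ-≡ _ _ 16 (+-cancelˡ-≡ (B ² ² + 2 * ((B + 2 * d) * B) ²) _ _ (begin
      B * B * (B * B) + 2 * ((B + 2 * d) * B * ((B + 2 * d) * B)) + 16 * (n * n)
        ≡⟨ solve (B ∷ d ∷ n ∷ []) ⟩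
      B * B * (B * B) + 2 * (2 * (2 * n * (2 * n)) + (B + 2 * d) * B * ((B + 2 * d) * B))
        ≡⟨ eq ⟨
      3 * ((B + 2 * d) * (B + 2 * d) * ((B + 2 * d) * (B + 2 * d)))
        ≡⟨ solve (B ∷ d ∷ []) ⟩
      B * B * (B * B) + 2 * ((B + 2 * d) * B * ((B + 2 * d) * B)) + 16 * ((B + d) * d * (B * B + 3 * B * d + 3 * (d * d))) ∎))
    solution : ∀ α β u → B + d ≡ α ² → d ≡ β ² → B ² + 3 * B * d + 3 * d ² ≡ u ² → Quartic⁺ α β u
    solution α β u c≡α² d≡β² K≡u² = begin
      α ² ² + α ² * β ² + β ² ²  ≡⟨ cong₂ (λ s t → s ² + s * t + t ²) c≡α² d≡β² ⟨
      (B + d) * (B + d) + (B + d) * d + d * d ≡⟨ solve (B ∷ d ∷ []) ⟩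
      B * B + 3 * B * d + 3 * (d * d)         ≡⟨ K≡u² ⟩
      u ² ∎

  coprime-2N² : ∀ {N M} → Odd M → Coprime N M → Coprime (2 * N ²) M
  coprime-2N² odd-M N⊥M = *-pres-coprimeˡ (Coprimality.sym (odd⇒coprime-2 odd-M)) (coprime-²ˡ N⊥M)

  quartic⁺-completed : ∀ {N M e} → Quartic⁺ N M e → (2 * e) ² ≡ (2 * N ² + M ²) ² + 3 * M ² ²
  quartic⁺-completed {N} {M} {e} sol = begin
    2 * e * (2 * e)                                     ≡⟨ solve (e ∷ []) ⟩
    4 * (e * e)                                         ≡⟨ cong (4 *_) sol ⟨
    4 * (N * N * (N * N) + N * N * (M * M) + M * M * (M * M))  ≡⟨ solve (N ∷ M ∷ []) ⟩
    (2 * (N * N) + M * M) * (2 * (N * N) + M * M) + 3 * (M * M * (M * M)) ∎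
    where open ≡-Reasoning

  coprime-2N²+M² : ∀ {N M} → Odd M → Coprime N M → Coprime (2 * N ² + M ²) M
  coprime-2N²+M² {N} {M} odd-M N⊥M {g} (g∣T , g∣M) =
    coprime-2N² odd-M N⊥M (∣m+n∣n⇒∣m g∣T (∣m⇒∣m*n M g∣M) , g∣M)

  -- (2e)² = T² + 3M⁴ with T = 2N² + M², so 3M⁴ = q(q + 2T) with coprime factors {3a⁴, b⁴} or {a⁴, 3b⁴}
  -- where ab = M; the first split is impossible mod 8 and the second is a reduced equation.
  quartic⁺-descends : Descent⁺.Descends
  quartic⁺-descends {M} record { x = N ; z = e ; even-x = n , refl ; x≢0 = N≢0 ; odd-y = odd-M ; x⊥y = N⊥M ; solution = sol }
    with q , q[q+2T]≡3M⁴ ← difference-of-squares {2 * e} {2 * N ² + M ²} (quartic⁺-completed {N} {M} {e} sol)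
    with a , b , refl , a⊥b , split ← coprime-3·fourth-power-product {q} {k = M}
           (coprime-q[q+2t] odd-M (coprime-2N²+M² odd-M N⊥M) q[q+2T]≡3M⁴) q[q+2T]≡3M⁴
    with split
  ... | inj₁ (refl , q+2T≡b⁴) = ⊥-elim (mod8-obstruction (2 * n * n) 0 odd-a odd-b (begin
    3 * (a * a * (a * a)) + 2 * (a * b * (a * b)) + 8 * (2 * n * n)              ≡⟨ solve (a ∷ b ∷ n ∷ []) ⟩
    3 * (a * a * (a * a)) + 2 * (2 * (2 * n * (2 * n)) + a * b * (a * b))       ≡⟨ q+2T≡b⁴ ⟩
    b ² ²                                                                    ≡⟨ +-identityʳ (b ² ²) ⟨
    b ² ² + 8 * 0                                                            ∎))
    where
    open ≡-Reasoning
    odd-a = proj₁ (odd-factors {a} {b} refl odd-M)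
    odd-b = proj₂ (odd-factors {a} {b} refl odd-M)
  ... | inj₂ (refl , q+2T≡3b⁴) =
    let y , y<b , nontrivial = descend-from-reduced⁺ {b} {a} {n} odd-b odd-a (Coprimality.sym a⊥b) n≢0 3b⁴≡
    in y , <-≤-trans y<b (factor≤product {a} {b} refl odd-M) , nontrivial
    where
    odd-a = proj₁ (odd-factors {a} {b} refl odd-M)
    odd-b = proj₂ (odd-factors {a} {b} refl odd-M)
    n≢0 : n ≢ 0
    n≢0 refl = N≢0 refl
    3b⁴≡ : 3 * b ² ² ≡ a ² ² + 2 * (2 * (2 * n) ² + (b * a) ²)
    3b⁴≡ = trans (sym q+2T≡3b⁴) (cong (λ t → a ² ² + 2 * (2 * (2 * n) ² + t ²)) (*-comm a b))

  quartic⁺-coprime-solution : ∀ {x y z} → Coprime x y → Quartic⁺ x y z → x ≡ 0 ⊎ y ≡ 0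
  quartic⁺-coprime-solution {x} {y} {z} x⊥y sol with even⊎odd x | even⊎odd y
  ... | inj₁ even-x | inj₁ even-y = ⊥-elim (even∧even⇒¬coprime even-x even-y x⊥y)
  ... | inj₁ even-x | inj₂ odd-y = inj₁ (Descent⁺.even-odd-solution⇒0 quartic⁺-descends {z = z} even-x odd-y x⊥y sol)
  ... | inj₂ odd-x | inj₁ even-y =
    inj₂ (Descent⁺.even-odd-solution⇒0 quartic⁺-descends {z = z} even-y odd-x (Coprimality.sym x⊥y) (quartic⁺-sym x y z sol))
  ... | inj₂ odd-x | inj₂ odd-y with i , x²≡ ← odd⇒²≡1+8k odd-x | j , y²≡ ← odd⇒²≡1+8k odd-y =
    ⊥-elim (²≢3+8k {z} (3 * i + 8 * i * i + j + 8 * i * j + 2 * j + 8 * j * j) (begin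
      z ² ≡⟨ sol ⟨
      x ² ² + x ² * y ² + y ² ²   ≡⟨ cong₂ (λ s t → s ² + s * t + t ²) x²≡ y²≡ ⟩
      (1 + 8 * i) * (1 + 8 * i) + (1 + 8 * i) * (1 + 8 * j) + (1 + 8 * j) * (1 + 8 * j) ≡⟨ solve (i ∷ j ∷ []) ⟩
      3 + 8 * (3 * i + 8 * i * i + j + 8 * i * j + 2 * j + 8 * j * j) ∎))
    where open ≡-Reasoning

  quartic⁻-quadrupled : ∀ {N M e} → Quartic⁻ N M e → (2 * e) ² + 2 * (2 * N ²) * M ² ≡ (2 * N ²) ² + 4 * M ² ²
  quartic⁻-quadrupled {N} {M} {e} sol = begin
    2 * e * (2 * e) + 2 * (2 * (N * N)) * (M * M)            ≡⟨ solve (e ∷ N ∷ M ∷ []) ⟩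
    4 * (e * e + N * N * (M * M))                           ≡⟨ cong (4 *_) sol ⟨
    4 * (N * N * (N * N) + M * M * (M * M))                 ≡⟨ solve (N ∷ M ∷ []) ⟩
    2 * (N * N) * (2 * (N * N)) + 4 * (M * M * (M * M))     ∎
    where open ≡-Reasoning

  quartic⁻-completed : ∀ {N M e} → Quartic⁻ N M e →
    ∃ λ T → (2 * e) ² ≡ T ² + 3 * M ² ² × (T + M ² ≡ 2 * N ² ⊎ 2 * N ² + T ≡ M ²)
  quartic⁻-completed {N} {M} {e} sol with ≤-total (M ²) (2 * N ²)
  ... | inj₁ M²≤2N² with T , M²+T≡2N² ← m≤n⇒∃[o]m+o≡n M²≤2N² =
    T , below {(2 * e) ²} {2 * N ²} {T} {M ²} T+M²≡2N² (quartic⁻-quadrupled {N} {M} {e} sol) , inj₁ T+M²≡2N²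
    where
    T+M²≡2N² = trans (+-comm T (M ²)) M²+T≡2N²
    below : ∀ {E P T m} → T + m ≡ P → E + 2 * P * m ≡ P * P + 4 * (m * m) → E ≡ T * T + 3 * (m * m)
    below {E} {_} {T} {m} refl eq = +-cancelʳ-≡ _ _ _ (trans eq (solve (T ∷ m ∷ [])))
  ... | inj₂ 2N²≤M² with T , 2N²+T≡M² ← m≤n⇒∃[o]m+o≡n 2N²≤M² =
    T , above {(2 * e) ²} {2 * N ²} {T} {M ²} 2N²+T≡M² (quartic⁻-quadrupled {N} {M} {e} sol) , inj₂ 2N²+T≡M²
    where
    above : ∀ {E P T m} → P + T ≡ m → E + 2 * P * m ≡ P * P + 4 * (m * m) → E ≡ T * T + 3 * (m * m)
    above {E} {P} {T} refl eq = +-cancelʳ-≡ _ _ _ (trans eq (solve (P ∷ T ∷ [])))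

  coprime-[2N²-M²] : ∀ {N M T} → Odd M → Coprime N M → T + M ² ≡ 2 * N ² ⊎ 2 * N ² + T ≡ M ² → Coprime T M
  coprime-[2N²-M²] {N} {M} {T} odd-M N⊥M (inj₁ T+M²≡2N²) {g} (g∣T , g∣M) =
    coprime-2N² odd-M N⊥M (subst (g ∣_) T+M²≡2N² (∣m∣n⇒∣m+n g∣T (∣m⇒∣m*n M g∣M)) , g∣M)
  coprime-[2N²-M²] {N} {M} {T} odd-M N⊥M (inj₂ 2N²+T≡M²) {g} (g∣T , g∣M) =
    coprime-2N² odd-M N⊥M (∣m+n∣n⇒∣m (subst (g ∣_) (sym 2N²+T≡M²) (∣m⇒∣m*n M g∣M)) g∣T , g∣M)

  reduced⁻⇒B≤A : ∀ {A B k} → A ² ² + 2 * (A * B) ² ≡ 3 * B ² ² + k → B ≤ A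
  reduced⁻⇒B≤A {A} {B} {k} eq with B ≤? A
  ... | yes B≤A = B≤A
  ... | no B≰A = contradiction eq (<⇒≢ (begin-strict
    A ² ² + 2 * (A * B) ²        ≡⟨ cong (λ t → A ² ² + 2 * t) (²-distrib-* A B) ⟩
    A ² ² + 2 * (A ² * B ²)      <⟨ +-mono-<-≤ (²-mono-< A²<B²) (*-monoʳ-≤ 2 (*-monoˡ-≤ (B ²) (<⇒≤ A²<B²))) ⟩
    B ² ² + 2 * (B ² * B ²)      ≡⟨ solve (B ∷ []) ⟩
    3 * B ² ²                    ≤⟨ m≤m+n (3 * B ² ²) k ⟩
    3 * B ² ² + k                ∎))
    where
    open ≤-Reasoning
    A²<B² = ²-mono-< (≰⇒> B≰A)

  descend-from-reduced⁻ : ∀ {A B n} → Odd A → Odd B → Coprime A B → n ≢ 0 →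
    A ² ² + 2 * (A * B) ² ≡ 3 * B ² ² + 4 * (2 * n) ² → ∃ λ y → y < A × Descent⁻.Nontrivial y
  descend-from-reduced⁻ {A} {B} {n} odd-A odd-B A⊥B n≢0 eq with odd-gap odd-B odd-A (reduced⁻⇒B≤A {k = 4 * (2 * n) ²} eq)
  ... | d , refl =
    Descent⁻.descend-from-factorisation B (B + d) odd-A A⊥B n≢0 n²≡cdK
      (B * B + B * d + d * d ≡ (B + d) * B + d * d ∋ solve (B ∷ d ∷ []))
      (B * B + B * d + d * d ≡ B * B + d * (B + d) ∋ solve (B ∷ d ∷ []))
      solution
    where
    open ≡-Reasoning
    n²≡cdK : n ² ≡ (B + d) * d * (B ² + B * d + d ²)
    n²≡cdK = *-cancelˡ-≡ _ _ 16 (+-cancelˡ-≡ (3 * B ² ²) _ _ (begin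
      3 * (B * B * (B * B)) + 16 * (n * n)                     ≡⟨ solve (B ∷ n ∷ []) ⟩
      3 * (B * B * (B * B)) + 4 * (2 * n * (2 * n))             ≡⟨ eq ⟨
      (B + 2 * d) * (B + 2 * d) * ((B + 2 * d) * (B + 2 * d)) + 2 * ((B + 2 * d) * B * ((B + 2 * d) * B))
        ≡⟨ solve (B ∷ d ∷ []) ⟩
      3 * (B * B * (B * B)) + 16 * ((B + d) * d * (B * B + B * d + d * d)) ∎))
    solution : ∀ α β u → B + d ≡ α ² → d ≡ β ² → B ² + B * d + d ² ≡ u ² → Quartic⁻ α β u
    solution α β u c≡α² d≡β² K≡u² = begin
      α ² ² + β ² ²                       ≡⟨ cong₂ (λ s t → s ² + t ²) c≡α² d≡β² ⟨
      (B + d) * (B + d) + d * d           ≡⟨ solve (B ∷ d ∷ []) ⟩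
      B * B + B * d + d * d + (B + d) * d ≡⟨ cong₂ _+_ K≡u² (cong₂ _*_ c≡α² d≡β²) ⟩
      u ² + α ² * β ²                     ∎

  private
    regroup : ∀ x t y → x + 2 * t + 2 * y ≡ x + 2 * (t + y)
    regroup = solve-∀

    2[2[2n]²]≡8[2n²] : ∀ n → 2 * (2 * (2 * n) ²) ≡ 8 * (2 * n * n)
    2[2[2n]²]≡8[2n²] n = 2 * (2 * (2 * n * (2 * n))) ≡ 8 * (2 * n * n) ∋ solve (n ∷ [])

  -- As for Quartic⁺, with T = |2N² - M²|.
  quartic⁻-descends : Descent⁻.Descends
  quartic⁻-descends {M} record { x = N ; z = e ; even-x = n , refl ; x≢0 = N≢0 ; odd-y = odd-M ; x⊥y = N⊥M ; solution = sol }
    with T , completed , side ← quartic⁻-completed {N} {M} {e} sol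
    with q , q[q+2T]≡3M⁴ ← difference-of-squares {2 * e} {T} completed
    with a , b , refl , a⊥b , split ← coprime-3·fourth-power-product {q} {k = M}
           (coprime-q[q+2t] odd-M (coprime-[2N²-M²] odd-M N⊥M side) q[q+2T]≡3M⁴) q[q+2T]≡3M⁴
    with side | split | odd-factors {a} {b} refl odd-M
  ... | inj₁ T+M²≡2N² | inj₁ (refl , q+2T≡b⁴) | odd-a , odd-b =
    let y , y<b , nontrivial = descend-from-reduced⁻ {b} {a} {n} odd-b odd-a (Coprimality.sym a⊥b) n≢0 (begin
          b ² ² + 2 * (b * a) ²                ≡⟨ cong₂ (λ s t → s + 2 * t ²) (sym q+2T≡b⁴) (*-comm b a) ⟩
          3 * a ² ² + 2 * T + 2 * (a * b) ²    ≡⟨ regroup (3 * a ² ²) T ((a * b) ²) ⟩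
          3 * a ² ² + 2 * (T + (a * b) ²)      ≡⟨ cong (λ t → 3 * a ² ² + 2 * t) T+M²≡2N² ⟩
          3 * a ² ² + 2 * (2 * (2 * n) ²)      ≡⟨ cong (3 * a ² ² +_) (*-assoc 2 2 ((2 * n) ²)) ⟨
          3 * a ² ² + 4 * (2 * n) ²            ∎)
    in y , <-≤-trans y<b (factor≤product {a} {b} refl odd-M) , nontrivial
    where
    open ≡-Reasoning
    n≢0 : n ≢ 0
    n≢0 refl = N≢0 refl
  ... | inj₁ T+M²≡2N² | inj₂ (refl , q+2T≡3b⁴) | odd-a , odd-b =
    ⊥-elim (mod8-obstruction 0 (2 * n * n) odd-b odd-a (begin
      3 * b ² ² + 2 * (b * a) ² + 8 * 0    ≡⟨ +-identityʳ _ ⟩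
      3 * b ² ² + 2 * (b * a) ²            ≡⟨ cong₂ (λ s t → s + 2 * t ²) (sym q+2T≡3b⁴) (*-comm b a) ⟩
      a ² ² + 2 * T + 2 * (a * b) ²        ≡⟨ regroup (a ² ²) T ((a * b) ²) ⟩
      a ² ² + 2 * (T + (a * b) ²)          ≡⟨ cong (λ t → a ² ² + 2 * t) T+M²≡2N² ⟩
      a ² ² + 2 * (2 * (2 * n) ²)          ≡⟨ cong (a ² ² +_) (2[2[2n]²]≡8[2n²] n) ⟩
      a ² ² + 8 * (2 * n * n)              ∎))
    where open ≡-Reasoning
  ... | inj₂ 2N²+T≡M² | inj₁ (refl , q+2T≡b⁴) | odd-a , odd-b =
    ⊥-elim (mod8-obstruction 0 (2 * n * n) odd-a odd-b (begin
      3 * a ² ² + 2 * (a * b) ² + 8 * 0          ≡⟨ +-identityʳ _ ⟩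
      3 * a ² ² + 2 * (a * b) ²                  ≡⟨ cong (λ t → 3 * a ² ² + 2 * t) 2N²+T≡M² ⟨
      3 * a ² ² + 2 * (2 * (2 * n) ² + T)        ≡⟨ cong (3 * a ² ² +_) (*-distribˡ-+ 2 (2 * (2 * n) ²) T) ⟩
      3 * a ² ² + (2 * (2 * (2 * n) ²) + 2 * T)  ≡⟨ cong (3 * a ² ² +_) (+-comm (2 * (2 * (2 * n) ²)) (2 * T)) ⟩
      3 * a ² ² + (2 * T + 2 * (2 * (2 * n) ²))  ≡⟨ +-assoc (3 * a ² ²) (2 * T) _ ⟨
      3 * a ² ² + 2 * T + 2 * (2 * (2 * n) ²)    ≡⟨ cong₂ _+_ q+2T≡b⁴ (2[2[2n]²]≡8[2n²] n) ⟩
      b ² ² + 8 * (2 * n * n)                    ∎))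
    where open ≡-Reasoning
  ... | inj₂ 2N²+T≡M² | inj₂ (refl , q+2T≡3b⁴) | odd-a , odd-b =
    let y , y<a , nontrivial = descend-from-reduced⁻ {a} {b} {n} odd-a odd-b a⊥b n≢0 (begin
          a ² ² + 2 * (a * b) ²                  ≡⟨ cong (λ t → a ² ² + 2 * t) 2N²+T≡M² ⟨
          a ² ² + 2 * (2 * (2 * n) ² + T)        ≡⟨ cong (a ² ² +_) (*-distribˡ-+ 2 (2 * (2 * n) ²) T) ⟩
          a ² ² + (2 * (2 * (2 * n) ²) + 2 * T)  ≡⟨ cong (a ² ² +_) (+-comm (2 * (2 * (2 * n) ²)) (2 * T)) ⟩
          a ² ² + (2 * T + 2 * (2 * (2 * n) ²))  ≡⟨ +-assoc (a ² ²) (2 * T) _ ⟨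
          a ² ² + 2 * T + 2 * (2 * (2 * n) ²)    ≡⟨ cong₂ _+_ q+2T≡3b⁴ (sym (*-assoc 2 2 ((2 * n) ²))) ⟩
          3 * b ² ² + 4 * (2 * n) ²              ∎)
    in y , <-≤-trans y<a (factor≤product {b} {a} (*-comm b a) odd-M) , nontrivial
    where
    open ≡-Reasoning
    n≢0 : n ≢ 0
    n≢0 refl = N≢0 refl

  quartic⁻-xy≤z : ∀ {x y z} → Quartic⁻ x y z → x * y ≤ z
  quartic⁻-xy≤z {x} {y} {z} sol = ²-cancel-≤ (+-cancelʳ-≤ ((x * y) ²) ((x * y) ²) (z ²) (begin
    (x * y) ² + (x * y) ²  ≡⟨ cong (λ t → t + t) (²-distrib-* x y) ⟩
    x ² * y ² + x ² * y ²  ≡⟨ cong (x ² * y ² +_) (+-identityʳ (x ² * y ²)) ⟨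
    2 * (x ² * y ²)        ≤⟨ 2mn≤m²+n² (x ²) (y ²) ⟩
    x ² ² + y ² ²          ≡⟨ sol ⟩
    z ² + x ² * y ²        ≡⟨ cong (z ² +_) (²-distrib-* x y) ⟨
    z ² + (x * y) ²        ∎))
    where open ≤-Reasoning

  quartic⁻-odd-z : ∀ {x y z} → Odd x → Odd y → Quartic⁻ x y z → Odd z
  quartic⁻-odd-z {x} {y} {z} odd-x odd-y sol with even⊎odd z
  ... | inj₂ odd-z = odd-z
  ... | inj₁ even-z = ⊥-elim (even⇒¬odd (odd+odd⇒even (odd⁴ odd-x) (odd⁴ odd-y))
                        (subst Odd (sym sol) (even+odd⇒odd (even⇒even² even-z) (*-pres-odd (odd² odd-x) (odd² odd-y)))))
    where
    odd² : ∀ {n} → Odd n → Odd (n ²)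
    odd² odd = *-pres-odd odd odd
    odd⁴ : ∀ {n} → Odd n → Odd (n ² ²)
    odd⁴ odd = odd² (odd² odd)

  quartic⁻-coprime-z : ∀ {x y z} → Coprime x y → Quartic⁻ x y z → Coprime z x
  quartic⁻-coprime-z {x} {y} {z} x⊥y sol {g} (g∣z , g∣x) = coprime-²ʳ (coprime-²ʳ x⊥y) (g∣x , g∣y⁴)
    where
    g∣y⁴ : g ∣ y ² ²
    g∣x² = ∣m⇒∣m*n x g∣x
    g∣y⁴ = ∣m+n∣m⇒∣n (subst (g ∣_) (sym sol) (∣m∣n⇒∣m+n (∣m⇒∣m*n z g∣z) (∣m⇒∣m*n (y ²) g∣x²))) (∣m⇒∣m*n (x ²) g∣x²)

  -- Writing e = NM + 2Y and N² = M² + 2D gives Y(NM + Y) = D², so NM + Y = p², Y = q² and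
  -- (p, q, M² + D) is a solution with p² + q² = e odd; the descent forces q = 0, i.e. D = 0.
  quartic⁻-odd-odd : ∀ {N M e} → Odd N → Odd M → Coprime N M → Quartic⁻ N M e → M ² ≤ N ² → N ≡ M
  quartic⁻-odd-odd {N} {M} {e} odd-N odd-M N⊥M sol M²≤N²
    with Y , refl ← odd-gap {N * M} {e} (*-pres-odd odd-N odd-M) (quartic⁻-odd-z {N} {M} {e} odd-N odd-M sol)
                            (quartic⁻-xy≤z {N} {M} {e} sol)
    with D , N²≡M²+2D ← odd-gap {M ²} {N ²} (*-pres-odd odd-M odd-M) (*-pres-odd odd-N odd-N) M²≤N²
    = finish (coprime-square-product {N * M + Y} {Y} {D} P+Y⊥Y (trans (*-comm (N * M + Y) Y) Y[P+Y]≡D²))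
    where
    open ≡-Reasoning
    Y[P+Y]≡D² : Y * (N * M + Y) ≡ D ²
    Y[P+Y]≡D² = *-cancelˡ-≡ _ _ 4 (+-cancelˡ-≡ (2 * (N ² * M ²)) _ _ (begin
      2 * (N * N * (M * M)) + 4 * (Y * (N * M + Y))    ≡⟨ solve (N ∷ M ∷ Y ∷ []) ⟩
      (N * M + 2 * Y) * (N * M + 2 * Y) + N * N * (M * M) ≡⟨ sol ⟨
      N ² ² + M ² ²                                     ≡⟨ cong (λ s → s ² + M ² ²) N²≡M²+2D ⟩
      (M * M + 2 * D) * (M * M + 2 * D) + M * M * (M * M) ≡⟨ solve (M ∷ D ∷ []) ⟩
      2 * ((M * M + 2 * D) * (M * M)) + 4 * (D * D)     ≡⟨ cong (λ s → 2 * (s * M ²) + 4 * D ²) N²≡M²+2D ⟨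
      2 * (N ² * M ²) + 4 * D ²                          ∎))
    P+Y⊥Y : Coprime (N * M + Y) Y
    P+Y⊥Y {h} (h∣P+Y , h∣Y) = e⊥M (h∣e , coprime-divisor (coprime-∣ˡ e⊥N h∣e) h∣P)
      where
      e⊥N = quartic⁻-coprime-z {N} {M} {N * M + 2 * Y} N⊥M sol
      e⊥M = quartic⁻-coprime-z {M} {N} {N * M + 2 * Y} (Coprimality.sym N⊥M) (quartic⁻-sym N M (N * M + 2 * Y) sol)
      h∣P : h ∣ N * M
      h∣P = ∣m+n∣n⇒∣m h∣P+Y h∣Y
      h∣e : h ∣ N * M + 2 * Y
      h∣e = ∣m∣n⇒∣m+n h∣P (∣n⇒∣m*n 2 h∣Y)
    finish : (∃₂ λ p q → N * M + Y ≡ p ² × Y ≡ q ² × p * q ≡ D × Coprime p q) → N ≡ M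
    finish (p , q , P+Y≡p² , Y≡q² , _ , p⊥q) = conclude (odd-sum-of-squares p q odd-p²+q²)
      where
      odd-p²+q² : Odd (p ² + q ²)
      odd-p²+q² = subst Odd (trans (N * M + 2 * Y ≡ N * M + Y + Y ∋ solve (N ∷ M ∷ Y ∷ [])) (cong₂ _+_ P+Y≡p² Y≡q²))
                    (quartic⁻-odd-z {N} {M} odd-N odd-M sol)
      sol′ : Quartic⁻ p q (M ² + D)
      sol′ = begin
        p ² ² + q ² ²                                          ≡⟨ cong₂ (λ s t → s ² + t ²) P+Y≡p² Y≡q² ⟨
        (N * M + Y) * (N * M + Y) + Y * Y                      ≡⟨ solve (N ∷ M ∷ Y ∷ []) ⟩
        N * M * (N * M) + Y * (N * M + Y) + (N * M + Y) * Y
          ≡⟨ cong₂ (λ s t → s + t + (N * M + Y) * Y) (²-distrib-* N M) Y[P+Y]≡D² ⟩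
        N ² * M ² + D ² + (N * M + Y) * Y                      ≡⟨ cong (λ s → s * M ² + D ² + (N * M + Y) * Y) N²≡M²+2D ⟩
        (M * M + 2 * D) * (M * M) + D * D + (N * M + Y) * Y    ≡⟨ solve (M ∷ D ∷ N ∷ Y ∷ []) ⟩
        (M * M + D) * (M * M + D) + (N * M + Y) * Y            ≡⟨ cong ((M ² + D) ² +_) (cong₂ _*_ P+Y≡p² Y≡q²) ⟩
        (M ² + D) ² + p ² * q ²                                ∎
      conclude : Even p × Odd q ⊎ Odd p × Even q → N ≡ M
      conclude (inj₁ (even-p , odd-q))
        with refl ← Descent⁻.even-odd-solution⇒0 quartic⁻-descends {z = M ² + D} even-p odd-q p⊥q sol′ =
        ⊥-elim (odd⇒≢0 (*-pres-odd odd-N odd-M) (m+n≡0⇒m≡0 (N * M) P+Y≡p²))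
      conclude (inj₂ (odd-p , even-q))
        with refl ← Descent⁻.even-odd-solution⇒0 quartic⁻-descends {z = M ² + D} even-q odd-p
                      (Coprimality.sym p⊥q) (quartic⁻-sym p q (M ² + D) sol′) =
        ²-injective (trans N²≡M²+2D (trans (cong (λ t → M ² + 2 * t) D≡0) (+-identityʳ (M ²))))
        where
        D≡0 : D ≡ 0
        D≡0 = ²-injective (trans (sym Y[P+Y]≡D²) (cong (_* (N * M + Y)) Y≡q²))

  quartic⁻-coprime-solution : ∀ {x y z} → Coprime x y → Quartic⁻ x y z → x ≡ 0 ⊎ y ≡ 0 ⊎ x ≡ y
  quartic⁻-coprime-solution {x} {y} {z} x⊥y sol with even⊎odd x | even⊎odd y
  ... | inj₁ even-x | inj₁ even-y = ⊥-elim (even∧even⇒¬coprime even-x even-y x⊥y)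
  ... | inj₁ even-x | inj₂ odd-y = inj₁ (Descent⁻.even-odd-solution⇒0 quartic⁻-descends {z = z} even-x odd-y x⊥y sol)
  ... | inj₂ odd-x | inj₁ even-y =
    inj₂ (inj₁ (Descent⁻.even-odd-solution⇒0 quartic⁻-descends {z = z} even-y odd-x (Coprimality.sym x⊥y)
                 (quartic⁻-sym x y z sol)))
  ... | inj₂ odd-x | inj₂ odd-y with ≤-total (y ²) (x ²)
  ...   | inj₁ y²≤x² = inj₂ (inj₂ (quartic⁻-odd-odd {x} {y} {z} odd-x odd-y x⊥y sol y²≤x²))
  ...   | inj₂ x²≤y² =
    inj₂ (inj₂ (sym (quartic⁻-odd-odd {y} {x} {z} odd-y odd-x (Coprimality.sym x⊥y) (quartic⁻-sym x y z sol) x²≤y²)))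

module RationalQuartic where

  open Arithmetic using (_²; 2mn≤m²+n²; coprime-²ˡ; coprime-²ʳ; ∣m+n∣n⇒∣m)
  open Quartic using (Quartic⁺; Quartic⁻; quartic⁺-coprime-solution; quartic⁻-coprime-solution)
  open import Data.Integer as ℤ using (ℤ; +_; -[1+_]; ∣_∣)
  import Data.Integer.Properties as ℤP
  import Data.Integer.Tactic.RingSolver as ℤ-Solver
  open import Data.Nat as ℕ using (ℕ; suc)
  import Data.Nat.Properties as ℕP
  open import Data.Nat.Divisibility using (_∣_; divides; ∣-antisym; ∣-refl; ∣m∣n⇒∣m+n; ∣m⇒∣m*n; ∣n⇒∣m*n)
  open import Data.Nat.Coprimality as Coprimality using (Coprime; coprime-divisor)
  open import Data.Rational as ℚ using (ℚ; mkℚ; 0ℚ; 1ℚ; toℚᵘ)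
  import Data.Rational.Properties as ℚP
  import Data.Rational.Unnormalised as ℚᵘ
  import Data.Rational.Unnormalised.Properties as ℚᵘP
  open import Data.Product using (_,_)
  open import Data.Sum using (_⊎_; inj₁; inj₂)
  open import Data.List using ([]; _∷_)
  open import Relation.Binary.PropositionalEquality

  open ℚᵘ using (_≃_; *≡*)

  -- Polynomials in natural-number constants: an identity between two of them proved in ℤ holds in ℕ.
  infixl 6 _:+_
  infixl 7 _:*_

  data Expr : Set where
    lit : ℕ → Expr
    _:+_ _:*_ : Expr → Expr → Expr

  ⟦_⟧ℕ : Expr → ℕ
  ⟦ lit n ⟧ℕ = n
  ⟦ e :+ f ⟧ℕ = ⟦ e ⟧ℕ ℕ.+ ⟦ f ⟧ℕ
  ⟦ e :* f ⟧ℕ = ⟦ e ⟧ℕ ℕ.* ⟦ f ⟧ℕ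

  ⟦_⟧ℤ : Expr → ℤ
  ⟦ lit n ⟧ℤ = + n
  ⟦ e :+ f ⟧ℤ = ⟦ e ⟧ℤ ℤ.+ ⟦ f ⟧ℤ
  ⟦ e :* f ⟧ℤ = ⟦ e ⟧ℤ ℤ.* ⟦ f ⟧ℤ

  ⟦⟧ℤ≡+⟦⟧ℕ : ∀ e → ⟦ e ⟧ℤ ≡ + ⟦ e ⟧ℕ
  ⟦⟧ℤ≡+⟦⟧ℕ (lit n) = refl
  ⟦⟧ℤ≡+⟦⟧ℕ (e :+ f) =
    trans (cong₂ ℤ._+_ (⟦⟧ℤ≡+⟦⟧ℕ e) (⟦⟧ℤ≡+⟦⟧ℕ f)) (sym (ℤP.pos-+ ⟦ e ⟧ℕ ⟦ f ⟧ℕ))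
  ⟦⟧ℤ≡+⟦⟧ℕ (e :* f) =
    trans (cong₂ ℤ._*_ (⟦⟧ℤ≡+⟦⟧ℕ e) (⟦⟧ℤ≡+⟦⟧ℕ f)) (sym (ℤP.pos-* ⟦ e ⟧ℕ ⟦ f ⟧ℕ))

  ℤ⇒ℕ : ∀ e f → ⟦ e ⟧ℤ ≡ ⟦ f ⟧ℤ → ⟦ e ⟧ℕ ≡ ⟦ f ⟧ℕ
  ℤ⇒ℕ e f eq = ℤP.+-injective (trans (sym (⟦⟧ℤ≡+⟦⟧ℕ e)) (trans eq (⟦⟧ℤ≡+⟦⟧ℕ f)))

  i*i≡+∣i∣² : ∀ i → i ℤ.* i ≡ + ((∣ i ∣) ²)
  i*i≡+∣i∣² (+ n) = ℤP.+◃n≡+n (n ℕ.* n)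
  i*i≡+∣i∣² -[1+ n ] = ℤP.+◃n≡+n (suc n ℕ.* suc n)

  toℚᵘ-quartic⁻ : ∀ u → let U = toℚᵘ u in
    toℚᵘ (u ℚ.* u ℚ.* (u ℚ.* u) ℚ.- u ℚ.* u ℚ.+ 1ℚ)
      ≃ U ℚᵘ.* U ℚᵘ.* (U ℚᵘ.* U) ℚᵘ.- U ℚᵘ.* U ℚᵘ.+ ℚᵘ.1ℚᵘ
  toℚᵘ-quartic⁻ u = ℚᵘP.≃-trans (ℚP.toℚᵘ-homo-+ (u² ℚ.* u² ℚ.- u²) 1ℚ)
    (ℚᵘP.+-congˡ ℚᵘ.1ℚᵘ (ℚᵘP.≃-trans (ℚP.toℚᵘ-homo-+ (u² ℚ.* u²) (ℚ.- u²))
      (ℚᵘP.+-cong (ℚᵘP.≃-trans (ℚP.toℚᵘ-homo-* u² u²) (ℚᵘP.*-cong U² U²))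
                  (ℚᵘP.≃-trans (ℚP.toℚᵘ-homo‿- u²) (ℚᵘP.-‿cong U²)))))
    where
    u² = u ℚ.* u
    U² = ℚP.toℚᵘ-homo-* u u

  toℚᵘ-quartic⁺ : ∀ u → let U = toℚᵘ u in
    toℚᵘ (u ℚ.* u ℚ.* (u ℚ.* u) ℚ.+ u ℚ.* u ℚ.+ 1ℚ)
      ≃ U ℚᵘ.* U ℚᵘ.* (U ℚᵘ.* U) ℚᵘ.+ U ℚᵘ.* U ℚᵘ.+ ℚᵘ.1ℚᵘ
  toℚᵘ-quartic⁺ u = ℚᵘP.≃-trans (ℚP.toℚᵘ-homo-+ (u² ℚ.* u² ℚ.+ u²) 1ℚ)
    (ℚᵘP.+-congˡ ℚᵘ.1ℚᵘ (ℚᵘP.≃-trans (ℚP.toℚᵘ-homo-+ (u² ℚ.* u²) u²)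
      (ℚᵘP.+-cong (ℚᵘP.≃-trans (ℚP.toℚᵘ-homo-* u² u²) (ℚᵘP.*-cong U² U²)) U²)))
    where
    u² = u ℚ.* u
    U² = ℚP.toℚᵘ-homo-* u u

  -- The hypotheses of cleared⁻ℤ and cleared⁺ℤ are u⁴ ∓ u² + 1 = r² cross-multiplied exactly as
  -- ℚᵘ computes it for u = x/y and r = a/b; s and t stand for x² and a².
  module _ where
    open import Data.Integer using (_+_; _*_; -_; 1ℤ)
    open ℤ-Solver using (solve)
    open ≡-Reasoning

    cleared⁻ℤ : ∀ x y a b s t → s ≡ x * x → t ≡ a * a →
      ((x * x * (x * x) * (y * y) + - (x * x) * (y * y * (y * y))) * 1ℤ + 1ℤ * (y * y * (y * y) * (y * y))) * (b * b)
        ≡ a * a * (y * y * (y * y) * (y * y) * 1ℤ) →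
      y * y * ((s * s + y * y * (y * y)) * (b * b)) ≡ y * y * (t * (y * y * (y * y)) + s * (y * y) * (b * b))
    cleared⁻ℤ x y a b _ _ refl refl raw = begin
      y * y * ((x * x * (x * x) + y * y * (y * y)) * (b * b))
        ≡⟨ solve (x ∷ y ∷ b ∷ []) ⟩
      ((x * x * (x * x) * (y * y) + - (x * x) * (y * y * (y * y))) * 1ℤ + 1ℤ * (y * y * (y * y) * (y * y))) * (b * b)
        + x * x * (y * y * (y * y)) * (b * b)
        ≡⟨ cong (_+ x * x * (y * y * (y * y)) * (b * b)) raw ⟩
      a * a * (y * y * (y * y) * (y * y) * 1ℤ) + x * x * (y * y * (y * y)) * (b * b)
        ≡⟨ solve (x ∷ y ∷ a ∷ b ∷ []) ⟩
      y * y * (a * a * (y * y * (y * y)) + x * x * (y * y) * (b * b)) ∎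

    cleared⁺ℤ : ∀ x y a b s t → s ≡ x * x → t ≡ a * a →
      ((x * x * (x * x) * (y * y) + x * x * (y * y * (y * y))) * 1ℤ + 1ℤ * (y * y * (y * y) * (y * y))) * (b * b)
        ≡ a * a * (y * y * (y * y) * (y * y) * 1ℤ) →
      y * y * ((s * s + s * (y * y) + y * y * (y * y)) * (b * b)) ≡ y * y * (t * (y * y * (y * y)))
    cleared⁺ℤ x y a b _ _ refl refl raw = begin
      y * y * ((x * x * (x * x) + x * x * (y * y) + y * y * (y * y)) * (b * b))
        ≡⟨ solve (x ∷ y ∷ b ∷ []) ⟩
      ((x * x * (x * x) * (y * y) + x * x * (y * y * (y * y))) * 1ℤ + 1ℤ * (y * y * (y * y) * (y * y))) * (b * b)
        ≡⟨ raw ⟩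
      a * a * (y * y * (y * y) * (y * y) * 1ℤ)
        ≡⟨ solve (y ∷ a ∷ []) ⟩
      y * y * (a * a * (y * y * (y * y))) ∎

  module _ where
    open import Data.Nat using (_+_; _*_)

    cleared⁻ : ∀ u r → u ℚ.* u ℚ.* (u ℚ.* u) ℚ.- u ℚ.* u ℚ.+ 1ℚ ≡ r ℚ.* r →
      let N = ∣ ℚ.↥ u ∣ ; M = ℚ.↧ₙ u ; A = ∣ ℚ.↥ r ∣ ; B = ℚ.↧ₙ r in
      (N ² ² + M ² ²) * B ² ≡ A ² * M ² ² + N ² * M ² * B ²
    cleared⁻ u@(mkℚ x d _) r@(mkℚ a e _) eq
      with *≡* raw ← ℚᵘP.≃-trans (ℚᵘP.≃-sym (toℚᵘ-quartic⁻ u))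
                       (ℚᵘP.≃-trans (ℚP.toℚᵘ-cong eq) (ℚP.toℚᵘ-homo-* r r)) =
      ℕP.*-cancelˡ-≡ _ _ (M * M) (ℤ⇒ℕ
        (lit M :* lit M :* ((lit S :* lit S :+ lit M :* lit M :* (lit M :* lit M)) :* (lit B :* lit B)))
        (lit M :* lit M :* (lit T :* (lit M :* lit M :* (lit M :* lit M)) :+ lit S :* (lit M :* lit M) :* (lit B :* lit B)))
        (cleared⁻ℤ x (+ M) a (+ B) (+ S) (+ T) (sym (i*i≡+∣i∣² x)) (sym (i*i≡+∣i∣² a)) raw))
      where
      M = suc d
      B = suc e
      S = ∣ x ∣ ²
      T = ∣ a ∣ ²

    cleared⁺ : ∀ u r → u ℚ.* u ℚ.* (u ℚ.* u) ℚ.+ u ℚ.* u ℚ.+ 1ℚ ≡ r ℚ.* r →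
      let N = ∣ ℚ.↥ u ∣ ; M = ℚ.↧ₙ u ; A = ∣ ℚ.↥ r ∣ ; B = ℚ.↧ₙ r in
      (N ² ² + N ² * M ² + M ² ²) * B ² ≡ A ² * M ² ²
    cleared⁺ u@(mkℚ x d _) r@(mkℚ a e _) eq
      with *≡* raw ← ℚᵘP.≃-trans (ℚᵘP.≃-sym (toℚᵘ-quartic⁺ u))
                       (ℚᵘP.≃-trans (ℚP.toℚᵘ-cong eq) (ℚP.toℚᵘ-homo-* r r)) =
      ℕP.*-cancelˡ-≡ _ _ (M * M) (ℤ⇒ℕ
        (lit M :* lit M :* ((lit S :* lit S :+ lit S :* (lit M :* lit M) :+ lit M :* lit M :* (lit M :* lit M)) :* (lit B :* lit B)))
        (lit M :* lit M :* (lit T :* (lit M :* lit M :* (lit M :* lit M))))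
        (cleared⁺ℤ x (+ M) a (+ B) (+ S) (+ T) (sym (i*i≡+∣i∣² x)) (sym (i*i≡+∣i∣² a)) raw))
      where
      M = suc d
      B = suc e
      S = ∣ x ∣ ²
      T = ∣ a ∣ ²

    square-denominator : ∀ {K A B M} → Coprime A B → Coprime M K → .{{ℕ.NonZero M}} →
      K * B ² ≡ A ² * M ² ² → K ≡ A ²
    square-denominator {K} {A} {B} {M} A⊥B M⊥K eq =
      ℕP.*-cancelʳ-≡ K (A ²) (M ² ²) {{M⁴≢0}} (trans (cong (K *_) (sym B²≡M⁴)) eq)
      where
      M⁴≢0 = ℕP.m*n≢0 (M ²) (M ²) {{ℕP.m*n≢0 M M}} {{ℕP.m*n≢0 M M}}
      B²≡M⁴ : B ² ≡ M ² ²
      B²≡M⁴ = ∣-antisym (coprime-divisor (coprime-²ˡ (coprime-²ʳ (Coprimality.sym A⊥B))) (divides K (sym eq)))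
                        (coprime-divisor (coprime-²ˡ (coprime-²ˡ M⊥K)) (divides (A ²) eq))

    ∣↥∣≡0⇒≡0 : ∀ u → ∣ ℚ.↥ u ∣ ≡ 0 → u ≡ 0ℚ
    ∣↥∣≡0⇒≡0 u N≡0 = ℚP.↥p≡0⇒p≡0 u (ℤP.∣i∣≡0⇒i≡0 N≡0)

    ∣↥∣≡↧⇒≡±1 : ∀ u → ∣ ℚ.↥ u ∣ ≡ ℚ.↧ₙ u → u ≡ 1ℚ ⊎ u ≡ ℚ.- 1ℚ
    ∣↥∣≡↧⇒≡±1 u@(mkℚ x d x⊥M) N≡M
      with Coprimality.recompute x⊥M (∣-refl , subst (∣ x ∣ ∣_) N≡M ∣-refl) | N≡M
    ∣↥∣≡↧⇒≡±1 (mkℚ (+ 1) 0 _) N≡M | refl | refl = inj₁ refl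
    ∣↥∣≡↧⇒≡±1 (mkℚ -[1+ 0 ] 0 _) N≡M | refl | refl = inj₂ refl

    quartic⁻-rational : ∀ u r → u ℚ.* u ℚ.* (u ℚ.* u) ℚ.- u ℚ.* u ℚ.+ 1ℚ ≡ r ℚ.* r →
      u ≡ 0ℚ ⊎ u ≡ 1ℚ ⊎ u ≡ ℚ.- 1ℚ
    quartic⁻-rational u@(mkℚ x d x⊥M) r@(mkℚ a e a⊥B) eq = conclude (quartic⁻-coprime-solution {z = ∣ a ∣} N⊥M sol)
      where
      N = ∣ x ∣
      M = suc d
      A = ∣ a ∣
      B = suc e
      N⊥M = Coprimality.recompute x⊥M
      sol : Quartic⁻ N M A
      sol with K , N²M²+K≡N⁴+M⁴ ← ℕP.m≤n⇒∃[o]m+o≡n (ℕP.≤-trans (ℕP.m≤n*m (N ² * M ²) 2) (2mn≤m²+n² (N ²) (M ²)))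
        =
        trans (sym N²M²+K≡N⁴+M⁴) (trans (cong (N ² * M ² +_) K≡A²) (ℕP.+-comm (N ² * M ²) (A ²)))
        where
        open ≡-Reasoning
        M⊥K : Coprime M K
        M⊥K {g} (g∣M , g∣K) = coprime-²ʳ (coprime-²ʳ (Coprimality.sym N⊥M)) (g∣M , g∣N⁴)
          where
          g∣M² = ∣m⇒∣m*n M g∣M
          g∣N⁴ = ∣m+n∣n⇒∣m (subst (g ∣_) N²M²+K≡N⁴+M⁴ (∣m∣n⇒∣m+n (∣n⇒∣m*n (N ²) g∣M²) g∣K))
                            (∣m⇒∣m*n (M ²) g∣M²)
        K≡A² : K ≡ A ²
        K≡A² = square-denominator (Coprimality.recompute a⊥B) M⊥K (ℕP.+-cancelˡ-≡ (N ² * M ² * B ²) _ _ (begin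
          N ² * M ² * B ² + K * B ²    ≡⟨ ℕP.*-distribʳ-+ (B ²) (N ² * M ²) K ⟨
          (N ² * M ² + K) * B ²        ≡⟨ cong (_* B ²) N²M²+K≡N⁴+M⁴ ⟩
          (N ² ² + M ² ²) * B ²        ≡⟨ cleared⁻ u r eq ⟩
          A ² * M ² ² + N ² * M ² * B ² ≡⟨ ℕP.+-comm (A ² * M ² ²) _ ⟩
          N ² * M ² * B ² + A ² * M ² ² ∎))
      conclude : N ≡ 0 ⊎ M ≡ 0 ⊎ N ≡ M → u ≡ 0ℚ ⊎ u ≡ 1ℚ ⊎ u ≡ ℚ.- 1ℚ
      conclude (inj₁ N≡0) = inj₁ (∣↥∣≡0⇒≡0 u N≡0)
      conclude (inj₂ (inj₂ N≡M)) = inj₂ (∣↥∣≡↧⇒≡±1 u N≡M)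

    quartic⁺-rational : ∀ u r → u ℚ.* u ℚ.* (u ℚ.* u) ℚ.+ u ℚ.* u ℚ.+ 1ℚ ≡ r ℚ.* r → u ≡ 0ℚ
    quartic⁺-rational u@(mkℚ x d x⊥M) r@(mkℚ a e a⊥B) eq = conclude (quartic⁺-coprime-solution {z = ∣ a ∣} N⊥M sol)
      where
      N = ∣ x ∣
      M = suc d
      N⊥M = Coprimality.recompute x⊥M
      M⊥K : Coprime M (N ² ² + N ² * M ² + M ² ²)
      M⊥K {g} (g∣M , g∣K) = coprime-²ʳ (coprime-²ʳ (Coprimality.sym N⊥M)) (g∣M , g∣N⁴)
        where
        g∣M² = ∣m⇒∣m*n M g∣M
        g∣N⁴ = ∣m+n∣n⇒∣m (∣m+n∣n⇒∣m g∣K (∣m⇒∣m*n (M ²) g∣M²)) (∣n⇒∣m*n (N ²) g∣M²)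
      sol : Quartic⁺ N M ∣ a ∣
      sol = square-denominator (Coprimality.recompute a⊥B) M⊥K (cleared⁺ u r eq)
      conclude : N ≡ 0 ⊎ M ≡ 0 → u ≡ 0ℚ
      conclude (inj₁ N≡0) = ∣↥∣≡0⇒≡0 u N≡0

module QuadraticField where

  open import Defs
  open import Data.Rational using (ℚ; _+_; _*_; _-_; -_; 0ℚ; 1ℚ; 1/_; ≢-nonZero)
  import Data.Rational.Properties as ℚP
  open import Data.Product using (∃; _,_)
  open import Data.Sum using (_⊎_; inj₁; inj₂; [_,_])
  open import Data.Empty using (⊥-elim)
  open import Data.List using ([]; _∷_)
  import Data.Maybe as Maybe
  open import Function.Base using (_∋_; id)
  open import Algebra.Bundles using (CommutativeRing)
  open import Algebra.Structures using (IsCommutativeRing)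
  open import Algebra.Solver.Ring.AlmostCommutativeRing as ACR using (_-Raw-AlmostCommutative⟶_)
  import Algebra.Solver.Ring
  open import Level using (0ℓ)
  open import Relation.Nullary using (¬_; Dec; yes; no)
  open import Relation.Binary.Definitions using (tri<; tri≈; tri>)
  open import Relation.Nullary.Decidable using (dec⇒maybe)
  open import Relation.Binary.PropositionalEquality hiding ([_])
  import Tactic.RingSolver.Core.AlmostCommutativeRing as TACR
  open import Tactic.RingSolver using (solve)

  ℚ-ring : TACR.AlmostCommutativeRing 0ℓ 0ℓ
  ℚ-ring = TACR.fromCommutativeRing ℚP.+-*-commutativeRing (λ x → dec⇒maybe (0ℚ ℚP.≟ x))

  module _ {d : ℚ} where

    ⟨⟩-cong : ∀ {a b c e} → a ≡ c → b ≡ e → ⟨_,_⟩ {d} a b ≡ ⟨ c , e ⟩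
    ⟨⟩-cong refl refl = refl

    QF-isCommutativeRing : IsCommutativeRing _≡_ _⊕_ _⊗_ ⊝_ (ι {d} 0ℚ) (ι 1ℚ)
    QF-isCommutativeRing = record
      { isRing = record
        { +-isAbelianGroup = record
          { isGroup = record
            { isMonoid = record
              { isSemigroup = record
                { isMagma = record { isEquivalence = isEquivalence ; ∙-cong = cong₂ _⊕_ }
                ; assoc = ⊕-assoc }
              ; identity = ⊕-identityˡ , ⊕-identityʳ }
            ; inverse = ⊕-inverseˡ , ⊕-inverseʳ
            ; ⁻¹-cong = cong ⊝_ }
          ; comm = ⊕-comm }
        ; *-cong = cong₂ _⊗_
        ; *-assoc = ⊗-assoc
        ; *-identity = ⊗-identityˡ , ⊗-identityʳ
        ; distrib = ⊗-distribˡ-⊕ , ⊗-distribʳ-⊕ }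
      ; *-comm = ⊗-comm }
      where
      ⊕-assoc : ∀ x y z → (x ⊕ y) ⊕ z ≡ x ⊕ (y ⊕ z)
      ⊕-assoc ⟨ a , b ⟩ ⟨ c , e ⟩ ⟨ f , g ⟩ = ⟨⟩-cong (ℚP.+-assoc a c f) (ℚP.+-assoc b e g)
      ⊕-comm : ∀ x y → x ⊕ y ≡ y ⊕ x
      ⊕-comm ⟨ a , b ⟩ ⟨ c , e ⟩ = ⟨⟩-cong (ℚP.+-comm a c) (ℚP.+-comm b e)
      ⊕-identityˡ : ∀ x → ι 0ℚ ⊕ x ≡ x
      ⊕-identityˡ ⟨ a , b ⟩ = ⟨⟩-cong (ℚP.+-identityˡ a) (ℚP.+-identityˡ b)
      ⊕-identityʳ : ∀ x → x ⊕ ι 0ℚ ≡ x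
      ⊕-identityʳ ⟨ a , b ⟩ = ⟨⟩-cong (ℚP.+-identityʳ a) (ℚP.+-identityʳ b)
      ⊕-inverseˡ : ∀ x → (⊝ x) ⊕ x ≡ ι 0ℚ
      ⊕-inverseˡ ⟨ a , b ⟩ = ⟨⟩-cong (ℚP.+-inverseˡ a) (ℚP.+-inverseˡ b)
      ⊕-inverseʳ : ∀ x → x ⊕ (⊝ x) ≡ ι 0ℚ
      ⊕-inverseʳ ⟨ a , b ⟩ = ⟨⟩-cong (ℚP.+-inverseʳ a) (ℚP.+-inverseʳ b)
      ⊗-assoc : ∀ x y z → (x ⊗ y) ⊗ z ≡ x ⊗ (y ⊗ z)
      ⊗-assoc ⟨ a , b ⟩ ⟨ c , e ⟩ ⟨ f , g ⟩ = ⟨⟩-cong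
        ((a * c + d * (b * e)) * f + d * ((a * e + b * c) * g) ≡ a * (c * f + d * (e * g)) + d * (b * (c * g + e * f))
          ∋ solve (a ∷ b ∷ c ∷ e ∷ f ∷ g ∷ d ∷ []) ℚ-ring)
        ((a * c + d * (b * e)) * g + (a * e + b * c) * f ≡ a * (c * g + e * f) + b * (c * f + d * (e * g))
          ∋ solve (a ∷ b ∷ c ∷ e ∷ f ∷ g ∷ d ∷ []) ℚ-ring)
      ⊗-comm : ∀ x y → x ⊗ y ≡ y ⊗ x
      ⊗-comm ⟨ a , b ⟩ ⟨ c , e ⟩ = ⟨⟩-cong
        (a * c + d * (b * e) ≡ c * a + d * (e * b) ∋ solve (a ∷ b ∷ c ∷ e ∷ d ∷ []) ℚ-ring)
        (a * e + b * c ≡ c * b + e * a ∋ solve (a ∷ b ∷ c ∷ e ∷ []) ℚ-ring)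
      ⊗-identityˡ : ∀ x → ι 1ℚ ⊗ x ≡ x
      ⊗-identityˡ ⟨ a , b ⟩ = ⟨⟩-cong
        (1ℚ * a + d * (0ℚ * b) ≡ a ∋ solve (a ∷ b ∷ d ∷ []) ℚ-ring)
        (1ℚ * b + 0ℚ * a ≡ b ∋ solve (a ∷ b ∷ []) ℚ-ring)
      ⊗-identityʳ : ∀ x → x ⊗ ι 1ℚ ≡ x
      ⊗-identityʳ x = trans (⊗-comm x (ι 1ℚ)) (⊗-identityˡ x)
      ⊗-distribˡ-⊕ : ∀ x y z → x ⊗ (y ⊕ z) ≡ (x ⊗ y) ⊕ (x ⊗ z)
      ⊗-distribˡ-⊕ ⟨ a , b ⟩ ⟨ c , e ⟩ ⟨ f , g ⟩ = ⟨⟩-cong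
        (a * (c + f) + d * (b * (e + g)) ≡ (a * c + d * (b * e)) + (a * f + d * (b * g))
          ∋ solve (a ∷ b ∷ c ∷ e ∷ f ∷ g ∷ d ∷ []) ℚ-ring)
        (a * (e + g) + b * (c + f) ≡ (a * e + b * c) + (a * g + b * f) ∋ solve (a ∷ b ∷ c ∷ e ∷ f ∷ g ∷ []) ℚ-ring)
      ⊗-distribʳ-⊕ : ∀ x y z → (y ⊕ z) ⊗ x ≡ (y ⊗ x) ⊕ (z ⊗ x)
      ⊗-distribʳ-⊕ x y z = trans (⊗-comm (y ⊕ z) x) (trans (⊗-distribˡ-⊕ x y z) (cong₂ _⊕_ (⊗-comm x y) (⊗-comm x z)))

    QF-commutativeRing : CommutativeRing 0ℓ 0ℓ
    QF-commutativeRing = record { isCommutativeRing = QF-isCommutativeRing }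

    open import Algebra.Properties.Group (CommutativeRing.+-group QF-commutativeRing) public
      using () renaming (∙-cancelʳ to ⊕-cancelʳ; x∙y⁻¹≈ε⇒x≈y to ⊖≡0⇒≡)

    ι-+ : ∀ a b → ι {d} (a + b) ≡ ι a ⊕ ι b
    ι-+ a b = ⟨⟩-cong refl (sym (ℚP.+-identityʳ 0ℚ))

    ι-* : ∀ a b → ι {d} (a * b) ≡ ι a ⊗ ι b
    ι-* a b = ⟨⟩-cong (a * b ≡ a * b + d * (0ℚ * 0ℚ) ∋ solve (a ∷ b ∷ d ∷ []) ℚ-ring)
                      (0ℚ ≡ a * 0ℚ + 0ℚ * b ∋ solve (a ∷ b ∷ []) ℚ-ring)

    ι-- : ∀ a b → ι {d} a ⊖ ι b ≡ ι (a - b)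
    ι-- a b = ⟨⟩-cong refl (ℚP.+-inverseʳ 0ℚ)

    ι-homomorphism : ℚP.+-*-rawRing -Raw-AlmostCommutative⟶ ACR.fromCommutativeRing QF-commutativeRing
    ι-homomorphism = record { ⟦_⟧ = ι ; +-homo = ι-+ ; *-homo = ι-* ; -‿homo = λ _ → refl ; 0-homo = refl ; 1-homo = refl }

    module QF-Solver = Algebra.Solver.Ring ℚP.+-*-rawRing (ACR.fromCommutativeRing QF-commutativeRing) ι-homomorphism
      (λ a b → Maybe.map (cong ι) (dec⇒maybe (a ℚP.≟ b)))

    norm : QF d → ℚ
    norm ⟨ a , b ⟩ = a * a - d * (b * b)

    norm-⊗ : ∀ x y → norm (x ⊗ y) ≡ norm x * norm y
    norm-⊗ ⟨ a , b ⟩ ⟨ c , e ⟩ =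
      (a * c + d * (b * e)) * (a * c + d * (b * e)) - d * ((a * e + b * c) * (a * e + b * c))
        ≡ (a * a - d * (b * b)) * (c * c - d * (e * e))
        ∋ solve (a ∷ b ∷ c ∷ e ∷ d ∷ []) ℚ-ring

    norm-0 : norm (ι {d} 0ℚ) ≡ 0ℚ
    norm-0 = 0ℚ * 0ℚ - d * (0ℚ * 0ℚ) ≡ 0ℚ ∋ solve (d ∷ []) ℚ-ring

  p*q≡0⇒p≡0⊎q≡0 : ∀ p q → p * q ≡ 0ℚ → p ≡ 0ℚ ⊎ q ≡ 0ℚ
  p*q≡0⇒p≡0⊎q≡0 p q pq≡0 with p ℚP.≟ 0ℚ
  ... | yes p≡0 = inj₁ p≡0
  ... | no p≢0 = inj₂ (begin
    q                ≡⟨ ℚP.*-identityˡ q ⟨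
    1ℚ * q           ≡⟨ cong (_* q) (ℚP.*-inverseˡ p) ⟨
    p⁻¹ * p * q      ≡⟨ ℚP.*-assoc p⁻¹ p q ⟩
    p⁻¹ * (p * q)    ≡⟨ cong (p⁻¹ *_) pq≡0 ⟩
    p⁻¹ * 0ℚ         ≡⟨ ℚP.*-zeroʳ p⁻¹ ⟩
    0ℚ               ∎)
    where
    open ≡-Reasoning
    instance _ = ≢-nonZero p≢0
    p⁻¹ = 1/ p

  p+p≡0⇒p≡0 : ∀ p → p + p ≡ 0ℚ → p ≡ 0ℚ
  p+p≡0⇒p≡0 p p+p≡0 with ℚP.<-cmp p 0ℚ
  ... | tri< p<0 _ _ = ⊥-elim (ℚP.<⇒≢ (ℚP.+-mono-< p<0 p<0) p+p≡0)
  ... | tri≈ _ p≡0 _ = p≡0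
  ... | tri> _ _ p>0 = ⊥-elim (ℚP.<⇒≢ (ℚP.+-mono-< p>0 p>0) (sym p+p≡0))

  0² : ℚ
  0² = 0ℚ * 0ℚ

  d*0²≡0 : ∀ d → d * 0² ≡ 0ℚ
  d*0²≡0 d = trans (cong (d *_) (ℚP.*-zeroˡ 0ℚ)) (ℚP.*-zeroʳ d)

  _IsSquareUpTo_ : ℚ → ℚ → Set
  q IsSquareUpTo d = IsSquare q ⊎ ∃ λ b → q ≡ d * (b * b)

  module _ {d : ℚ} (d-nonsquare : ¬ IsSquare d) where

    norm≡0⇒≡0 : ∀ (z : QF d) → norm z ≡ 0ℚ → z ≡ ι 0ℚ
    norm≡0⇒≡0 ⟨ a , b ⟩ norm≡0 = conclude (b ℚP.≟ 0ℚ)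
      where
      open ≡-Reasoning
      a²≡db² : a * a ≡ d * (b * b)
      a²≡db² = begin
        a * a                             ≡⟨ solve (a ∷ b ∷ d ∷ []) ℚ-ring ⟩
        a * a - d * (b * b) + d * (b * b) ≡⟨ cong (_+ d * (b * b)) norm≡0 ⟩
        0ℚ + d * (b * b)                  ≡⟨ ℚP.+-identityˡ _ ⟩
        d * (b * b)                       ∎
      conclude : Dec (b ≡ 0ℚ) → ⟨ a , b ⟩ ≡ ι 0ℚ
      conclude (yes b≡0) = ⟨⟩-cong ([ id , id ] (p*q≡0⇒p≡0⊎q≡0 a a a²≡0)) b≡0
        where
        a²≡0 = trans a²≡db² (trans (cong (λ t → d * (t * t)) b≡0) (d*0²≡0 d))
      conclude (no b≢0) = ⊥-elim (d-nonsquare (a * 1/ b , square-of-ratio (1/ b) (ℚP.*-inverseʳ b)))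
        where
        instance _ = ≢-nonZero b≢0
        square-of-ratio : ∀ c → b * c ≡ 1ℚ → (a * c) * (a * c) ≡ d
        square-of-ratio c bc≡1 = begin
          a * c * (a * c)           ≡⟨ solve (a ∷ c ∷ []) ℚ-ring ⟩
          a * a * (c * c)           ≡⟨ cong (_* (c * c)) a²≡db² ⟩
          d * (b * b) * (c * c)     ≡⟨ solve (d ∷ b ∷ c ∷ []) ℚ-ring ⟩
          d * (b * c) * (b * c)     ≡⟨ cong (λ t → d * t * t) bc≡1 ⟩
          d * 1ℚ * 1ℚ               ≡⟨ solve (d ∷ []) ℚ-ring ⟩
          d                         ∎

    x⊗y≡0⇒x≡0⊎y≡0 : ∀ (x y : QF d) → x ⊗ y ≡ ι 0ℚ → x ≡ ι 0ℚ ⊎ y ≡ ι 0ℚ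
    x⊗y≡0⇒x≡0⊎y≡0 x y xy≡0 = conclude (p*q≡0⇒p≡0⊎q≡0 (norm x) (norm y) Nx*Ny≡0)
      where
      Nx*Ny≡0 : norm x * norm y ≡ 0ℚ
      Nx*Ny≡0 = trans (sym (norm-⊗ x y)) (trans (cong norm xy≡0) (norm-0 {d}))
      conclude : norm x ≡ 0ℚ ⊎ norm y ≡ 0ℚ → x ≡ ι 0ℚ ⊎ y ≡ ι 0ℚ
      conclude (inj₁ Nx≡0) = inj₁ (norm≡0⇒≡0 x Nx≡0)
      conclude (inj₂ Ny≡0) = inj₂ (norm≡0⇒≡0 y Ny≡0)

    ⊗-inverse : ∀ (z : QF d) → z ≢ ι 0ℚ → ∃ λ w → z ⊗ w ≡ ι 1ℚ
    ⊗-inverse z@(⟨ a , b ⟩) z≢0 with norm z ℚP.≟ 0ℚ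
    ... | yes Nz≡0 = ⊥-elim (z≢0 (norm≡0⇒≡0 z Nz≡0))
    ... | no Nz≢0 = ⟨ a * n , - (b * n) ⟩ , ⟨⟩-cong (trans (re-identity n) (ℚP.*-inverseʳ (norm z))) (im-identity n)
      where
      instance _ = ≢-nonZero Nz≢0
      n = 1/ norm z
      re-identity : ∀ n → a * (a * n) + d * (b * - (b * n)) ≡ (a * a - d * (b * b)) * n
      re-identity n = solve (a ∷ b ∷ d ∷ n ∷ []) ℚ-ring
      im-identity : ∀ n → a * - (b * n) + b * (a * n) ≡ 0ℚ
      im-identity n = solve (a ∷ b ∷ n ∷ []) ℚ-ring
    ι-square : ∀ q (s : QF d) → ι q ≡ s ⊗ s → q IsSquareUpTo d
    ι-square q ⟨ a , b ⟩ q≡s² = conclude (p*q≡0⇒p≡0⊎q≡0 (a + a) b [a+a]b≡0)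
      where
      open ≡-Reasoning
      [a+a]b≡0 : (a + a) * b ≡ 0ℚ
      [a+a]b≡0 = sym (trans (cong im q≡s²) (a * b + b * a ≡ (a + a) * b ∋ solve (a ∷ b ∷ []) ℚ-ring))
      conclude : a + a ≡ 0ℚ ⊎ b ≡ 0ℚ → q IsSquareUpTo d
      conclude (inj₂ b≡0) = inj₁ (a , sym (begin
        q                     ≡⟨ cong re q≡s² ⟩
        a * a + d * (b * b)   ≡⟨ cong (λ t → a * a + d * (t * t)) b≡0 ⟩
        a * a + d * 0²        ≡⟨ cong (a * a +_) (d*0²≡0 d) ⟩
        a * a + 0ℚ            ≡⟨ ℚP.+-identityʳ (a * a) ⟩
        a * a                 ∎))
      conclude (inj₁ a+a≡0) = inj₂ (b , (begin
        q                     ≡⟨ cong re q≡s² ⟩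
        a * a + d * (b * b)   ≡⟨ cong (λ t → t * t + d * (b * b)) (p+p≡0⇒p≡0 a a+a≡0) ⟩
        0² + d * (b * b)      ≡⟨ cong (_+ d * (b * b)) (ℚP.*-zeroˡ 0ℚ) ⟩
        0ℚ + d * (b * b)      ≡⟨ ℚP.+-identityˡ (d * (b * b)) ⟩
        d * (b * b)           ∎))

    d*q-square⇒ι-q-square : ∀ q → IsSquare (d * q) → ∃ λ (r : QF d) → ι q ≡ r ⊗ r
    d*q-square⇒ι-q-square q (s , s²≡dq) = ⟨ 0ℚ , t ⟩ , ⟨⟩-cong (begin
        q                       ≡⟨ dt²≡q s (1/ d) s²≡dq (ℚP.*-inverseʳ d) ⟨
        d * (t * t)             ≡⟨ ℚP.+-identityˡ (d * (t * t)) ⟨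
        0ℚ + d * (t * t)        ≡⟨ cong (_+ d * (t * t)) (ℚP.*-zeroˡ 0ℚ) ⟨
        0² + d * (t * t)        ∎) (begin
        0ℚ                      ≡⟨ ℚP.+-identityˡ 0ℚ ⟨
        0ℚ + 0ℚ                 ≡⟨ cong₂ _+_ (ℚP.*-zeroˡ t) (ℚP.*-zeroʳ t) ⟨
        0ℚ * t + t * 0ℚ         ∎)
      where
      open ≡-Reasoning
      d≢0 : d ≢ 0ℚ
      d≢0 d≡0 = d-nonsquare (0ℚ , sym d≡0)
      instance _ = ≢-nonZero d≢0
      t = s * 1/ d
      dt²≡q : ∀ s i → s * s ≡ d * q → d * i ≡ 1ℚ → d * ((s * i) * (s * i)) ≡ q
      dt²≡q s i s²≡dq di≡1 = begin
        d * ((s * i) * (s * i))   ≡⟨ solve (d ∷ s ∷ i ∷ []) ℚ-ring ⟩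
        (s * s) * (d * i) * i     ≡⟨ cong₂ (λ a b → a * b * i) s²≡dq di≡1 ⟩
        d * q * 1ℚ * i            ≡⟨ solve (d ∷ q ∷ i ∷ []) ℚ-ring ⟩
        q * (d * i)               ≡⟨ cong (q *_) di≡1 ⟩
        q * 1ℚ                    ≡⟨ ℚP.*-identityʳ q ⟩
        q                         ∎

module Curve where

  open import Defs
  open QuadraticField
  open import Data.Rational using (ℚ; _+_; _*_; 0ℚ; 1ℚ)
  open import Data.Product using (∃; _×_; _,_; proj₁; proj₂)
  open import Data.Sum using (_⊎_; inj₁; inj₂; [_,_])
  open import Function.Base using (id)
  open import Relation.Nullary using (¬_)
  open import Relation.Binary.PropositionalEquality hiding ([_])

  module _ {d : ℚ} (L : ℚ) where
    open QF-Solver {d}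
    open ≡-Reasoning

    cubic : QF d → QF d
    cubic X = X ⊗ (X ⊖ ι 1ℚ) ⊗ (X ⊖ ι L)

    -- The tangent at (x, y) meets the curve twice at x and once more at the abscissa x₂ of the double.
    tangent-identity : ∀ {x y l x₂} → OnCurve L d x y →
      l ⊗ (ι 2ℚ ⊗ y) ≡ ι 3ℚ ⊗ x ⊗ x ⊖ ι (2ℚ * (1ℚ + L)) ⊗ x ⊕ ι L →
      x₂ ≡ l ⊗ l ⊕ ι (1ℚ + L) ⊖ ι 2ℚ ⊗ x →
      ∀ X → cubic X ≡ (l ⊗ (X ⊖ x) ⊕ y) ⊗ (l ⊗ (X ⊖ x) ⊕ y) ⊕ (X ⊖ x) ⊗ (X ⊖ x) ⊗ (X ⊖ x₂)
    tangent-identity {x} {y} {l} {x₂} on-curve tangent refl X = ⊕-cancelʳ (cubic x ⊕ slope ⊗ (X ⊖ x)) _ _ (begin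
      cubic X ⊕ (cubic x ⊕ slope ⊗ (X ⊖ x))
        ≡⟨ cong₂ (λ s t → cubic X ⊕ (s ⊕ t ⊗ (X ⊖ x))) on-curve (trans tangent slope≡) ⟨
      cubic X ⊕ (y ⊗ y ⊕ (l ⊗ (ι 2ℚ ⊗ y)) ⊗ (X ⊖ x))
        ≡⟨ identity X x y l (ι L) ⟩
      (l ⊗ (X ⊖ x) ⊕ y) ⊗ (l ⊗ (X ⊖ x) ⊕ y) ⊕ (X ⊖ x) ⊗ (X ⊖ x) ⊗ (X ⊖ (l ⊗ l ⊕ (ι 1ℚ ⊕ ι L) ⊖ ι 2ℚ ⊗ x))
        ⊕ (cubic x ⊕ slope ⊗ (X ⊖ x))
        ≡⟨ cong (λ t → (l ⊗ (X ⊖ x) ⊕ y) ⊗ (l ⊗ (X ⊖ x) ⊕ y) ⊕ (X ⊖ x) ⊗ (X ⊖ x) ⊗ (X ⊖ (l ⊗ l ⊕ t ⊖ ι 2ℚ ⊗ x))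
                     ⊕ (cubic x ⊕ slope ⊗ (X ⊖ x))) (ι-+ 1ℚ L) ⟨
      (l ⊗ (X ⊖ x) ⊕ y) ⊗ (l ⊗ (X ⊖ x) ⊕ y) ⊕ (X ⊖ x) ⊗ (X ⊖ x) ⊗ (X ⊖ (l ⊗ l ⊕ ι (1ℚ + L) ⊖ ι 2ℚ ⊗ x))
        ⊕ (cubic x ⊕ slope ⊗ (X ⊖ x)) ∎)
      where
      slope = ι 3ℚ ⊗ x ⊗ x ⊖ (ι 2ℚ ⊗ (ι 1ℚ ⊕ ι L)) ⊗ x ⊕ ι L
      slope≡ : ι 3ℚ ⊗ x ⊗ x ⊖ ι (2ℚ * (1ℚ + L)) ⊗ x ⊕ ι L ≡ slope
      slope≡ = cong (λ t → ι 3ℚ ⊗ x ⊗ x ⊖ t ⊗ x ⊕ ι L) (trans (ι-* 2ℚ (1ℚ + L)) (cong (ι 2ℚ ⊗_) (ι-+ 1ℚ L)))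
      identity : ∀ X x y l Λ → X ⊗ (X ⊖ ι 1ℚ) ⊗ (X ⊖ Λ) ⊕ (y ⊗ y ⊕ (l ⊗ (ι 2ℚ ⊗ y)) ⊗ (X ⊖ x)) ≡
        (l ⊗ (X ⊖ x) ⊕ y) ⊗ (l ⊗ (X ⊖ x) ⊕ y) ⊕ (X ⊖ x) ⊗ (X ⊖ x) ⊗ (X ⊖ (l ⊗ l ⊕ (ι 1ℚ ⊕ Λ) ⊖ ι 2ℚ ⊗ x)) ⊕
        (x ⊗ (x ⊖ ι 1ℚ) ⊗ (x ⊖ Λ) ⊕ (ι 3ℚ ⊗ x ⊗ x ⊖ (ι 2ℚ ⊗ (ι 1ℚ ⊕ Λ)) ⊗ x ⊕ Λ) ⊗ (X ⊖ x))
      identity = solve 5 (λ X x y l Λ → X :* (X :- con 1ℚ) :* (X :- Λ) :+ (y :* y :+ (l :* (con 2ℚ :* y)) :* (X :- x)) :=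
        (l :* (X :- x) :+ y) :* (l :* (X :- x) :+ y) :+ (X :- x) :* (X :- x) :* (X :- (l :* l :+ (con 1ℚ :+ Λ) :- con 2ℚ :* x)) :+
        (x :* (x :- con 1ℚ) :* (x :- Λ) :+ (con 3ℚ :* x :* x :- (con 2ℚ :* (con 1ℚ :+ Λ)) :* x :+ Λ) :* (X :- x))) refl

    cubic-0 : cubic (ι 0ℚ) ≡ ι 0ℚ
    cubic-0 = solve 1 (λ Λ → con 0ℚ :* (con 0ℚ :- con 1ℚ) :* (con 0ℚ :- Λ) := con 0ℚ) refl (ι L)

    cubic-1 : cubic (ι 1ℚ) ≡ ι 0ℚ
    cubic-1 = solve 1 (λ Λ → con 1ℚ :* (con 1ℚ :- con 1ℚ) :* (con 1ℚ :- Λ) := con 0ℚ) refl (ι L)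

    cubic-L : cubic (ι L) ≡ ι 0ℚ
    cubic-L = solve 1 (λ Λ → Λ :* (Λ :- con 1ℚ) :* (Λ :- Λ) := con 0ℚ) refl (ι L)

  module _ {d : ℚ} (d-nonsquare : ¬ IsSquare d) (L : ℚ) where
    open QF-Solver {d}
    open ≡-Reasoning

    cubic-roots : ∀ X → cubic L X ≡ ι 0ℚ → X ≡ ι 0ℚ ⊎ X ≡ ι 1ℚ ⊎ X ≡ ι L
    cubic-roots X root = split (x⊗y≡0⇒x≡0⊎y≡0 d-nonsquare (X ⊗ (X ⊖ ι 1ℚ)) (X ⊖ ι L) root)
      where
      split : X ⊗ (X ⊖ ι 1ℚ) ≡ ι 0ℚ ⊎ X ⊖ ι L ≡ ι 0ℚ → X ≡ ι 0ℚ ⊎ X ≡ ι 1ℚ ⊎ X ≡ ι L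
      split (inj₂ X-L≡0) = inj₂ (inj₂ (⊖≡0⇒≡ X (ι L) X-L≡0))
      split (inj₁ X[X-1]≡0) = split′ (x⊗y≡0⇒x≡0⊎y≡0 d-nonsquare X (X ⊖ ι 1ℚ) X[X-1]≡0)
        where
        split′ : X ≡ ι 0ℚ ⊎ X ⊖ ι 1ℚ ≡ ι 0ℚ → X ≡ ι 0ℚ ⊎ X ≡ ι 1ℚ ⊎ X ≡ ι L
        split′ (inj₁ X≡0) = inj₁ X≡0
        split′ (inj₂ X-1≡0) = inj₂ (inj₁ (⊖≡0⇒≡ X (ι 1ℚ) X-1≡0))

    order-4⇒square-differences : HasPointOfOrder4 L d →
      ∃ λ x₂ → (x₂ ≡ ι 0ℚ ⊎ x₂ ≡ ι 1ℚ ⊎ x₂ ≡ ι L) × (∀ e → cubic L e ≡ ι 0ℚ → ∃ λ s → x₂ ⊖ e ≡ s ⊗ s)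
    order-4⇒square-differences (x , y , x₂ , y₂ , on-curve , (y≢0 , l , tangent , x₂≡ , y₂≡) , y₂≡0) =
      x₂ , cubic-roots x₂ (trans (cubic≡ x₂) x₂-root) , difference-square
      where
      y≡ : l ⊗ (x ⊖ x₂) ≡ y
      y≡ = ⊖≡0⇒≡ (l ⊗ (x ⊖ x₂)) y (trans (sym y₂≡) y₂≡0)
      cubic≡ : ∀ X → cubic L X ≡ (l ⊗ (X ⊖ x₂)) ⊗ (l ⊗ (X ⊖ x₂)) ⊕ (X ⊖ x) ⊗ (X ⊖ x) ⊗ (X ⊖ x₂)
      cubic≡ X = trans (tangent-identity L {x} {y} {l} {x₂} on-curve tangent x₂≡ X)
        (cong (λ t → t ⊗ t ⊕ (X ⊖ x) ⊗ (X ⊖ x) ⊗ (X ⊖ x₂)) (trans (cong (l ⊗ (X ⊖ x) ⊕_) (sym y≡))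
          (solve 4 (λ X x l x₂ → l :* (X :- x) :+ l :* (x :- x₂) := l :* (X :- x₂)) refl X x l x₂)))
      x₂-root : (l ⊗ (x₂ ⊖ x₂)) ⊗ (l ⊗ (x₂ ⊖ x₂)) ⊕ (x₂ ⊖ x) ⊗ (x₂ ⊖ x) ⊗ (x₂ ⊖ x₂) ≡ ι 0ℚ
      x₂-root = solve 3 (λ x₂ x l → (l :* (x₂ :- x₂)) :* (l :* (x₂ :- x₂)) :+ (x₂ :- x) :* (x₂ :- x) :* (x₂ :- x₂)
                                    := con 0ℚ) refl x₂ x l
      difference-square : ∀ e → cubic L e ≡ ι 0ℚ → ∃ λ s → x₂ ⊖ e ≡ s ⊗ s
      difference-square e root = l ⊗ (e ⊖ x₂) ⊗ v , (begin
        x₂ ⊖ e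
          ≡⟨ solve 1 (λ t → t := t :* (con 1ℚ :* con 1ℚ)) refl (x₂ ⊖ e) ⟩
        (x₂ ⊖ e) ⊗ (ι 1ℚ ⊗ ι 1ℚ)
          ≡⟨ cong (λ t → (x₂ ⊖ e) ⊗ (t ⊗ t)) [e-x]v≡1 ⟨
        (x₂ ⊖ e) ⊗ (((e ⊖ x) ⊗ v) ⊗ ((e ⊖ x) ⊗ v))
          ≡⟨ solve 3 (λ a b v → a :* ((b :* v) :* (b :* v)) := (a :* (b :* b)) :* (v :* v)) refl (x₂ ⊖ e) (e ⊖ x) v ⟩
        ((x₂ ⊖ e) ⊗ ((e ⊖ x) ⊗ (e ⊖ x))) ⊗ (v ⊗ v)
          ≡⟨ cong (_⊗ (v ⊗ v)) [x₂-e][e-x]²≡p² ⟩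
        (p ⊗ p) ⊗ (v ⊗ v)
          ≡⟨ solve 2 (λ p v → (p :* p) :* (v :* v) := (p :* v) :* (p :* v)) refl p v ⟩
        (p ⊗ v) ⊗ (p ⊗ v) ∎)
        where
        p = l ⊗ (e ⊖ x₂)
        e-x≢0 : e ⊖ x ≢ ι 0ℚ
        e-x≢0 e-x≡0 = y≢0 ([ id , id ] (x⊗y≡0⇒x≡0⊎y≡0 d-nonsquare y y y²≡0))
          where
          y²≡0 = trans on-curve (trans (cong (cubic L) (sym (⊖≡0⇒≡ e x e-x≡0))) root)
        v = proj₁ (⊗-inverse d-nonsquare (e ⊖ x) e-x≢0)
        [e-x]v≡1 = proj₂ (⊗-inverse d-nonsquare (e ⊖ x) e-x≢0)
        [x₂-e][e-x]²≡p² : (x₂ ⊖ e) ⊗ ((e ⊖ x) ⊗ (e ⊖ x)) ≡ p ⊗ p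
        [x₂-e][e-x]²≡p² = begin
          (x₂ ⊖ e) ⊗ ((e ⊖ x) ⊗ (e ⊖ x))
            ≡⟨ solve 4 (λ x₂ e x p → (x₂ :- e) :* ((e :- x) :* (e :- x))
                                    := p :* p :- (p :* p :+ (e :- x) :* (e :- x) :* (e :- x₂))) refl x₂ e x p ⟩
          p ⊗ p ⊖ (p ⊗ p ⊕ (e ⊖ x) ⊗ (e ⊖ x) ⊗ (e ⊖ x₂))
            ≡⟨ cong (p ⊗ p ⊖_) (trans (sym (cubic≡ e)) root) ⟩
          p ⊗ p ⊖ ι 0ℚ
            ≡⟨ solve 1 (λ q → q :- con 0ℚ := q) refl (p ⊗ p) ⟩
          p ⊗ p ∎

    point-of-order-4 : ∀ r → ι L ≡ ι 1ℚ ⊖ r ⊗ r → r ≢ ι 0ℚ → ι 1ℚ ⊕ r ≢ ι 0ℚ → HasPointOfOrder4 L d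
    point-of-order-4 r L≡1-r² r≢0 1+r≢0 =
      ι 1ℚ ⊕ r , r ⊗ (ι 1ℚ ⊕ r) , ι 1ℚ , ι 0ℚ , on-curve , (y≢0 , ι 1ℚ ⊕ r , tangent , x₂≡ , y₂≡) , refl
      where
      1+L≡ : ι (1ℚ + L) ≡ ι 1ℚ ⊕ (ι 1ℚ ⊖ r ⊗ r)
      1+L≡ = trans (ι-+ 1ℚ L) (cong (ι 1ℚ ⊕_) L≡1-r²)
      on-curve : (r ⊗ (ι 1ℚ ⊕ r)) ⊗ (r ⊗ (ι 1ℚ ⊕ r)) ≡ (ι 1ℚ ⊕ r) ⊗ ((ι 1ℚ ⊕ r) ⊖ ι 1ℚ) ⊗ ((ι 1ℚ ⊕ r) ⊖ ι L)
      on-curve = trans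
        (solve 1 (λ r → (r :* (con 1ℚ :+ r)) :* (r :* (con 1ℚ :+ r))
                     := (con 1ℚ :+ r) :* ((con 1ℚ :+ r) :- con 1ℚ) :* ((con 1ℚ :+ r) :- (con 1ℚ :- r :* r))) refl r)
        (cong (λ t → (ι 1ℚ ⊕ r) ⊗ ((ι 1ℚ ⊕ r) ⊖ ι 1ℚ) ⊗ ((ι 1ℚ ⊕ r) ⊖ t)) (sym L≡1-r²))
      y≢0 : r ⊗ (ι 1ℚ ⊕ r) ≢ ι 0ℚ
      y≢0 y≡0 = [ r≢0 , 1+r≢0 ] (x⊗y≡0⇒x≡0⊎y≡0 d-nonsquare r (ι 1ℚ ⊕ r) y≡0)
      tangent : (ι 1ℚ ⊕ r) ⊗ (ι 2ℚ ⊗ (r ⊗ (ι 1ℚ ⊕ r))) ≡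
                ι 3ℚ ⊗ (ι 1ℚ ⊕ r) ⊗ (ι 1ℚ ⊕ r) ⊖ ι (2ℚ * (1ℚ + L)) ⊗ (ι 1ℚ ⊕ r) ⊕ ι L
      tangent = trans
        (solve 1 (λ r → (con 1ℚ :+ r) :* (con 2ℚ :* (r :* (con 1ℚ :+ r)))
                     := con 3ℚ :* (con 1ℚ :+ r) :* (con 1ℚ :+ r)
                          :- (con 2ℚ :* (con 1ℚ :+ (con 1ℚ :- r :* r))) :* (con 1ℚ :+ r) :+ (con 1ℚ :- r :* r)) refl r)
        (sym (cong₂ (λ s t → ι 3ℚ ⊗ (ι 1ℚ ⊕ r) ⊗ (ι 1ℚ ⊕ r) ⊖ s ⊗ (ι 1ℚ ⊕ r) ⊕ t)
                    (trans (ι-* 2ℚ (1ℚ + L)) (cong (ι 2ℚ ⊗_) 1+L≡)) L≡1-r²))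
      x₂≡ : ι 1ℚ ≡ (ι 1ℚ ⊕ r) ⊗ (ι 1ℚ ⊕ r) ⊕ ι (1ℚ + L) ⊖ ι 2ℚ ⊗ (ι 1ℚ ⊕ r)
      x₂≡ = trans
        (solve 1 (λ r → con 1ℚ := (con 1ℚ :+ r) :* (con 1ℚ :+ r) :+ (con 1ℚ :+ (con 1ℚ :- r :* r)) :- con 2ℚ :* (con 1ℚ :+ r))
               refl r)
        (cong (λ t → (ι 1ℚ ⊕ r) ⊗ (ι 1ℚ ⊕ r) ⊕ t ⊖ ι 2ℚ ⊗ (ι 1ℚ ⊕ r)) (sym 1+L≡))
      y₂≡ : ι 0ℚ ≡ (ι 1ℚ ⊕ r) ⊗ ((ι 1ℚ ⊕ r) ⊖ ι 1ℚ) ⊖ r ⊗ (ι 1ℚ ⊕ r)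
      y₂≡ = solve 1 (λ r → con 0ℚ := (con 1ℚ :+ r) :* ((con 1ℚ :+ r) :- con 1ℚ) :- r :* (con 1ℚ :+ r)) refl r

module LegendreParameter where

  open import Defs using (IsSquare)
  open QuadraticField using (ℚ-ring)
  open RationalQuartic using (quartic⁻-rational; quartic⁺-rational)
  open import Data.Rational using (ℚ; _+_; _*_; _-_; -_; 0ℚ; 1ℚ; 1/_; ≢-nonZero)
  import Data.Rational.Properties as ℚP
  open import Data.Product using (∃; _,_; proj₁; proj₂)
  open import Data.Empty using (⊥)
  open import Data.Sum using (_⊎_; inj₁; inj₂; [_,_])
  open import Data.List using ([]; _∷_)
  open import Function.Base using (_∋_)
  open import Relation.Nullary using (¬_)
  open import Relation.Binary.PropositionalEquality hiding ([_])
  open import Tactic.RingSolver using (solve)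

  square-t²-t+1∧square-t⇒t≡0⊎t≡1 : ∀ t → IsSquare (t * t - t + 1ℚ) → IsSquare t → t ≡ 0ℚ ⊎ t ≡ 1ℚ
  square-t²-t+1∧square-t⇒t≡0⊎t≡1 t (r , r²≡) (a , a²≡t) = conclude (quartic⁻-rational a r quartic)
    where
    quartic : a * a * (a * a) - a * a + 1ℚ ≡ r * r
    quartic = trans (cong (λ s → s * s - s + 1ℚ) a²≡t) (sym r²≡)
    conclude : a ≡ 0ℚ ⊎ a ≡ 1ℚ ⊎ a ≡ - 1ℚ → t ≡ 0ℚ ⊎ t ≡ 1ℚ
    conclude (inj₁ refl) = inj₁ (sym a²≡t)
    conclude (inj₂ (inj₁ refl)) = inj₂ (sym a²≡t)
    conclude (inj₂ (inj₂ refl)) = inj₂ (sym a²≡t)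

  square-t²-t+1∧square-[-t]⇒t≡0 : ∀ t → IsSquare (t * t - t + 1ℚ) → IsSquare (- t) → t ≡ 0ℚ
  square-t²-t+1∧square-[-t]⇒t≡0 t (r , r²≡) (c , c²≡-t) = begin
    t              ≡⟨ -c²≡t ⟨
    - (c * c)      ≡⟨ cong (λ s → - (s * s)) (quartic⁺-rational c r quartic) ⟩
    - (0ℚ * 0ℚ)    ≡⟨⟩
    0ℚ             ∎
    where
    open ≡-Reasoning
    -c²≡t : - (c * c) ≡ t
    -c²≡t = trans (cong -_ c²≡-t) (- (- t) ≡ t ∋ solve (t ∷ []) ℚ-ring)
    quartic : c * c * (c * c) + c * c + 1ℚ ≡ r * r
    quartic = begin
      c * c * (c * c) + c * c + 1ℚ               ≡⟨ solve (c ∷ []) ℚ-ring ⟩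
      - (c * c) * - (c * c) - - (c * c) + 1ℚ     ≡⟨ cong (λ s → s * s - s + 1ℚ) -c²≡t ⟩
      t * t - t + 1ℚ                             ≡⟨ r²≡ ⟨
      r * r                                      ∎

  ¬square-[-1] : ¬ IsSquare (- 1ℚ)
  ¬square-[-1] sq = ℚP.1≢0 (square-t²-t+1∧square-[-t]⇒t≡0 1ℚ (1ℚ , t²≡t²-t+t 1ℚ) sq)
    where
    t²≡t²-t+t : ∀ t → t * t ≡ t * t - t + t
    t²≡t²-t+t t = solve (t ∷ []) ℚ-ring

  t²-t+1-sym : ∀ t → (1ℚ - t) * (1ℚ - t) - (1ℚ - t) + 1ℚ ≡ t * t - t + 1ℚ
  t²-t+1-sym t = solve (t ∷ []) ℚ-ring

  1-t≡0⇒t≡1 : ∀ t → 1ℚ - t ≡ 0ℚ → t ≡ 1ℚ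
  1-t≡0⇒t≡1 t 1-t≡0 =
    trans (t ≡ 1ℚ - (1ℚ - t) ∋ solve (t ∷ []) ℚ-ring) (trans (cong (λ s → 1ℚ - s) 1-t≡0) (ℚP.+-identityʳ 1ℚ))

  1-t≡1⇒t≡0 : ∀ t → 1ℚ - t ≡ 1ℚ → t ≡ 0ℚ
  1-t≡1⇒t≡0 t 1-t≡1 =
    trans (t ≡ 1ℚ - (1ℚ - t) ∋ solve (t ∷ []) ℚ-ring) (trans (cong (λ s → 1ℚ - s) 1-t≡1) (ℚP.+-inverseʳ 1ℚ))

  module _ {L : ℚ} (L≢0 : L ≢ 0ℚ) (L≢1 : L ≢ 1ℚ) (L²-L+1-square : IsSquare (L * L - L + 1ℚ)) where

    private
      L²-L+1-square-sym : IsSquare ((1ℚ - L) * (1ℚ - L) - (1ℚ - L) + 1ℚ)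
      L²-L+1-square-sym = subst IsSquare (sym (t²-t+1-sym L)) L²-L+1-square

    ¬square-L : ¬ IsSquare L
    ¬square-L sq = [ L≢0 , L≢1 ] (square-t²-t+1∧square-t⇒t≡0⊎t≡1 L L²-L+1-square sq)

    ¬square-1-L : ¬ IsSquare (1ℚ - L)
    ¬square-1-L sq = [ (λ 1-L≡0 → L≢1 (1-t≡0⇒t≡1 L 1-L≡0)) , (λ 1-L≡1 → L≢0 (1-t≡1⇒t≡0 L 1-L≡1)) ]
                       (square-t²-t+1∧square-t⇒t≡0⊎t≡1 (1ℚ - L) L²-L+1-square-sym sq)

    ¬square-[-L] : ¬ IsSquare (- L)
    ¬square-[-L] sq = L≢0 (square-t²-t+1∧square-[-t]⇒t≡0 L L²-L+1-square sq)

    ¬square-L-1 : ¬ IsSquare (L - 1ℚ)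
    ¬square-L-1 sq = L≢1 (1-t≡0⇒t≡1 L (square-t²-t+1∧square-[-t]⇒t≡0 (1ℚ - L) L²-L+1-square-sym
                       (subst IsSquare (L - 1ℚ ≡ - (1ℚ - L) ∋ solve (L ∷ []) ℚ-ring) sq)))

    -- t = 1 - 1/L would be a square with t² - t + 1 = (L² - L + 1)/L².
    ¬square-L[L-1] : ¬ IsSquare (L * (L - 1ℚ))
    ¬square-L[L-1] (w , w²≡) = for-inverse (proj₁ L²-L+1-square) (proj₂ L²-L+1-square) (1/ L) (ℚP.*-inverseʳ L)
      where
      instance _ = ≢-nonZero L≢0
      for-inverse : ∀ r → r * r ≡ L * L - L + 1ℚ → ∀ k → L * k ≡ 1ℚ → ⊥
      for-inverse r r²≡ k Lk≡1 =
        [ (λ 1-k≡0 → L≢1 (L≡1 (1-t≡0⇒t≡1 k 1-k≡0))) , (λ 1-k≡1 → ℚP.1≢0 (1≡0 (1-t≡1⇒t≡0 k 1-k≡1))) ]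
          (square-t²-t+1∧square-t⇒t≡0⊎t≡1 (1ℚ - k) t²-t+1-square-at-1-k (w * k , [wk]²≡1-k))
        where
        open ≡-Reasoning
        L≡1 : k ≡ 1ℚ → L ≡ 1ℚ
        L≡1 k≡1 = trans (sym (ℚP.*-identityʳ L)) (trans (cong (L *_) (sym k≡1)) Lk≡1)
        1≡0 : k ≡ 0ℚ → 1ℚ ≡ 0ℚ
        1≡0 k≡0 = trans (sym Lk≡1) (trans (cong (L *_) k≡0) (ℚP.*-zeroʳ L))
        [wk]²≡1-k : (w * k) * (w * k) ≡ 1ℚ - k
        [wk]²≡1-k = begin
          (w * k) * (w * k)              ≡⟨ solve (w ∷ k ∷ []) ℚ-ring ⟩
          (w * w) * (k * k)              ≡⟨ cong (_* (k * k)) w²≡ ⟩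
          L * (L - 1ℚ) * (k * k)         ≡⟨ solve (L ∷ k ∷ []) ℚ-ring ⟩
          (L * k) * (L * k) - (L * k) * k ≡⟨ cong (λ s → s * s - s * k) Lk≡1 ⟩
          1ℚ * 1ℚ - 1ℚ * k               ≡⟨ solve (k ∷ []) ℚ-ring ⟩
          1ℚ - k                         ∎
        t²-t+1-square-at-1-k : IsSquare ((1ℚ - k) * (1ℚ - k) - (1ℚ - k) + 1ℚ)
        t²-t+1-square-at-1-k = r * k , (begin
          (r * k) * (r * k)                              ≡⟨ solve (r ∷ k ∷ []) ℚ-ring ⟩
          (r * r) * (k * k)                              ≡⟨ cong (_* (k * k)) r²≡ ⟩
          (L * L - L + 1ℚ) * (k * k)                     ≡⟨ solve (L ∷ k ∷ []) ℚ-ring ⟩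
          (L * k) * (L * k) - (L * k) * k + k * k        ≡⟨ cong (λ s → s * s - s * k + k * k) Lk≡1 ⟩
          1ℚ * 1ℚ - 1ℚ * k + k * k                       ≡⟨ solve (k ∷ []) ℚ-ring ⟩
          (1ℚ - k) * (1ℚ - k) - (1ℚ - k) + 1ℚ            ∎)

open QuadraticField
open Curve
open LegendreParameter

open import Defs
open import Data.Rational using (ℚ; _*_; _-_; _+_; -_; 0ℚ; 1ℚ)
import Data.Rational.Properties as ℚP
open import Data.Product using (∃; _,_; proj₁; proj₂)
open import Data.Sum using (_⊎_; inj₁; inj₂)
open import Data.Empty using (⊥; ⊥-elim)
open import Data.List using ([]; _∷_)
open import Function.Base using (_∋_)
open import Function.Bundles using (_⇔_; mk⇔)
open import Relation.Nullary using (¬_)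
open import Relation.Binary.PropositionalEquality
open import Tactic.RingSolver using (solve)

module _ {d : ℚ} (d-nonsquare : ¬ IsSquare d) {L : ℚ} (L≢0 : L ≢ 0ℚ) (L≢1 : L ≢ 1ℚ)
         (L²-L+1-square : IsSquare (L * L - L + 1ℚ)) where

  d-square-product : ∀ {p q} b f → p ≡ d * (b * b) → q ≡ d * (f * f) → IsSquare (p * q)
  d-square-product b f refl refl = d * b * f , solve (d ∷ b ∷ f ∷ []) ℚ-ring

  ι-difference-square : ∀ c e → (∃ λ s → ι c ⊖ ι e ≡ s ⊗ s) → (c - e) IsSquareUpTo d
  ι-difference-square c e (s , c-e≡s²) = ι-square d-nonsquare (c - e) s (trans (sym (ι-- c e)) c-e≡s²)

  square-differences⇒square : ∀ x₂ → x₂ ≡ ι 0ℚ ⊎ x₂ ≡ ι 1ℚ ⊎ x₂ ≡ ι L →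
    (∀ e → cubic L e ≡ ι 0ℚ → ∃ λ s → x₂ ⊖ e ≡ s ⊗ s) → IsSquare (d * (1ℚ - L))
  square-differences⇒square _ (inj₁ refl) sq = ⊥-elim (at-0
    (ι-difference-square 0ℚ 1ℚ (sq (ι 1ℚ) (cubic-1 L))) (ι-difference-square 0ℚ L (sq (ι L) (cubic-L L))))
    where
    at-0 : (0ℚ - 1ℚ) IsSquareUpTo d → (0ℚ - L) IsSquareUpTo d → ⊥
    at-0 (inj₁ sq) _ = ¬square-[-1] (subst IsSquare (ℚP.+-identityˡ (- 1ℚ)) sq)
    at-0 _ (inj₁ sq) = ¬square-[-L] L≢0 L≢1 L²-L+1-square (subst IsSquare (ℚP.+-identityˡ (- L)) sq)
    at-0 (inj₂ (b , eb)) (inj₂ (f , ef)) = ¬square-L L≢0 L≢1 L²-L+1-square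
      (subst IsSquare ((0ℚ - 1ℚ) * (0ℚ - L) ≡ L ∋ solve (L ∷ []) ℚ-ring) (d-square-product b f eb ef))
  square-differences⇒square _ (inj₂ (inj₁ refl)) sq = at-1 (ι-difference-square 1ℚ L (sq (ι L) (cubic-L L)))
    where
    at-1 : (1ℚ - L) IsSquareUpTo d → IsSquare (d * (1ℚ - L))
    at-1 (inj₁ sq) = ⊥-elim (¬square-1-L L≢0 L≢1 L²-L+1-square sq)
    at-1 (inj₂ (b , eb)) =
      d * b , trans (d * b * (d * b) ≡ d * (d * (b * b)) ∋ solve (d ∷ b ∷ []) ℚ-ring) (cong (d *_) (sym eb))
  square-differences⇒square _ (inj₂ (inj₂ refl)) sq = ⊥-elim (at-L
    (ι-difference-square L 0ℚ (sq (ι 0ℚ) (cubic-0 L))) (ι-difference-square L 1ℚ (sq (ι 1ℚ) (cubic-1 L))))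
    where
    at-L : (L - 0ℚ) IsSquareUpTo d → (L - 1ℚ) IsSquareUpTo d → ⊥
    at-L (inj₁ sq) _ = ¬square-L L≢0 L≢1 L²-L+1-square (subst IsSquare (ℚP.+-identityʳ L) sq)
    at-L _ (inj₁ sq) = ¬square-L-1 L≢0 L≢1 L²-L+1-square sq
    at-L (inj₂ (b , eb)) (inj₂ (f , ef)) = ¬square-L[L-1] L≢0 L≢1 L²-L+1-square
      (subst IsSquare (cong (_* (L - 1ℚ)) (ℚP.+-identityʳ L)) (d-square-product b f eb ef))

  order-4⇒square : HasPointOfOrder4 L d → IsSquare (d * (1ℚ - L))
  order-4⇒square P = let x₂ , x₂∈roots , differences = order-4⇒square-differences d-nonsquare L P
                     in square-differences⇒square x₂ x₂∈roots differences

  square⇒order-4 : IsSquare (d * (1ℚ - L)) → HasPointOfOrder4 L d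
  square⇒order-4 sq = point-of-order-4 d-nonsquare L r L≡1-r² r≢0 1+r≢0
    where
    open QF-Solver {d} using (_:=_; _:*_; _:+_; _:-_; con)
    open ≡-Reasoning
    r = proj₁ (d*q-square⇒ι-q-square d-nonsquare (1ℚ - L) sq)
    1-L≡r² = proj₂ (d*q-square⇒ι-q-square d-nonsquare (1ℚ - L) sq)
    L≡1-r² : ι L ≡ ι 1ℚ ⊖ r ⊗ r
    L≡1-r² = begin
      ι L                ≡⟨ cong ι (L ≡ 1ℚ - (1ℚ - L) ∋ solve (L ∷ []) ℚ-ring) ⟩
      ι (1ℚ - (1ℚ - L))  ≡⟨ ι-- 1ℚ (1ℚ - L) ⟨
      ι 1ℚ ⊖ ι (1ℚ - L)  ≡⟨ cong (ι 1ℚ ⊖_) 1-L≡r² ⟩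
      ι 1ℚ ⊖ r ⊗ r       ∎
    r≢0 : r ≢ ι 0ℚ
    r≢0 r≡0 = L≢1 (1-t≡0⇒t≡1 L (cong re (begin
      ι (1ℚ - L)         ≡⟨ 1-L≡r² ⟩
      r ⊗ r              ≡⟨ cong (λ a → a ⊗ a) r≡0 ⟩
      ι 0ℚ ⊗ ι 0ℚ        ≡⟨ QF-Solver.solve 0 (con 0ℚ :* con 0ℚ := con 0ℚ) refl ⟩
      ι 0ℚ               ∎)))
    1+r≢0 : ι 1ℚ ⊕ r ≢ ι 0ℚ
    1+r≢0 1+r≡0 = L≢0 (1-t≡1⇒t≡0 L (cong re (begin
      ι (1ℚ - L)                         ≡⟨ 1-L≡r² ⟩
      r ⊗ r                              ≡⟨ QF-Solver.solve 1 (λ r → r :* r := (con 1ℚ :+ r) :* (r :- con 1ℚ) :+ con 1ℚ) refl r ⟩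
      (ι 1ℚ ⊕ r) ⊗ (r ⊖ ι 1ℚ) ⊕ ι 1ℚ     ≡⟨ cong (λ a → a ⊗ (r ⊖ ι 1ℚ) ⊕ ι 1ℚ) 1+r≡0 ⟩
      ι 0ℚ ⊗ (r ⊖ ι 1ℚ) ⊕ ι 1ℚ           ≡⟨ QF-Solver.solve 1 (λ r → con 0ℚ :* (r :- con 1ℚ) :+ con 1ℚ := con 1ℚ) refl r ⟩
      ι 1ℚ                               ∎)))

proposition3p6 : (L : ℚ) → ¬ (L ≡ 0ℚ) → ¬ (L ≡ 1ℚ) → IsSquare (L * L - L + 1ℚ)
    → (d : ℚ) → ¬ IsSquare d
    → HasPointOfOrder4 L d ⇔ IsSquare (d * (1ℚ - L))
proposition3p6 L L≢0 L≢1 L²-L+1-square d d-nonsquare =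
  mk⇔ (order-4⇒square d-nonsquare L≢0 L≢1 L²-L+1-square) (square⇒order-4 d-nonsquare L≢0 L≢1 L²-L+1-square)
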